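{- Let $(G,\ell)$ be an instance of \textsc{Geometric Thickness} with $n=|V(G)|$ and $m=|E(G)|$. Then there is an existential first-order formula over the reals (an ETR formula) in $2n+m$ variables, whose atoms are polynomial (in)equalities of total degree at most $6$, using $O(n^4)$ polynomial (in)equalities, that is true if and only if $G$ admits a geometric $\ell$-layer drawing.
   Context: A straight-line drawing $\Gamma$ of a simple graph $G$ maps vertices to distinct points of $\mathbb{R}^2$, edges being drawn as straight-line segments. A geometric $\ell$-layer drawing of $G$ is a pair $(\Gamma,\chi)$ with $\chi\colon E(G)\to[\ell]$ such that no two edges of the same color cross in $\Gamma$. \textsc{Geometric Thickness}: given $G$ and $\ell$, decide whether $G$ admits a geometric $\ell$-layer drawing. An ETR formula is a sentence of the form $\exists x_1,\dots,x_N\colon\varphi$ where $\varphi$ is a quantifier-free Boolean combination of atoms $p\,\sigma\,0$ with $p$ a real polynomial in $x_1,\dots,x_N$ and $\sigma\in\{<,\le,=,\ge,>\}$. -}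

module Defs where

open import Level using (0ℓ)
open import Data.Nat as ℕ using (ℕ; zero; suc; _⊔_)
open import Data.Integer as ℤ using (ℤ; +_; -[1+_])
open import Data.Fin using (Fin)
open import Data.List using (List; []; _∷_)
open import Data.Product using (Σ; ∃; ∃-syntax; _×_; _,_; proj₁; proj₂)
open import Data.Sum using (_⊎_)
open import Relation.Nullary using (¬_)
open import Relation.Binary.PropositionalEquality using (_≡_; _≢_)
open import Algebra.Structures using (IsCommutativeRing)

-- The real numbers, axiomatised as a Dedekind-complete ordered field.
-- (agda-stdlib has no reals; every model of this record is isomorphic
-- to ℝ, and the theorem is stated for an arbitrary such model.)

record RealField : Set₁ where
  infixl 6 _+_
  infixl 7 _*_
  infix 4 _<_ _≤_
  field
    Carrier : Set
    _+_ _*_ : Carrier → Carrier → Carrier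
    -_      : Carrier → Carrier
    0# 1#   : Carrier
    isCommutativeRing : IsCommutativeRing _≡_ _+_ _*_ -_ 0# 1#
    0≢1     : 0# ≢ 1#
    inverse : ∀ x → x ≢ 0# → ∃[ y ] (x * y ≡ 1#)
    _<_     : Carrier → Carrier → Set
    <-irrefl : ∀ x → ¬ (x < x)
    <-trans  : ∀ {x y z} → x < y → y < z → x < z
    <-total  : ∀ x y → x < y ⊎ (x ≡ y ⊎ y < x)
    +-mono-< : ∀ {x y} z → x < y → x + z < y + z
    *-pos    : ∀ {x y} → 0# < x → 0# < y → 0# < x * y
    sup : (P : Carrier → Set) → ∃[ x ] P x → ∃[ b ] (∀ x → P x → x < b ⊎ x ≡ b) →
          ∃[ s ] ((∀ x → P x → x < s ⊎ x ≡ s) ×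
                  (∀ b → (∀ x → P x → x < b ⊎ x ≡ b) → s < b ⊎ s ≡ b))

  _≤_ : Carrier → Carrier → Set
  x ≤ y = x < y ⊎ x ≡ y

  _-_ : Carrier → Carrier → Carrier
  x - y = x + (- y)

  fromℕ : ℕ → Carrier
  fromℕ zero    = 0#
  fromℕ (suc k) = 1# + fromℕ k

  fromℤ : ℤ → Carrier
  fromℤ (+ k)      = fromℕ k
  fromℤ -[1+ k ]   = - (1# + fromℕ k)

  _^_ : Carrier → ℕ → Carrier
  x ^ zero  = 1#
  x ^ suc k = x * (x ^ k)

-- Polynomials with integer coefficients in N variables x₀ … x_{N-1},
-- given as a list of monomials  c · ∏ᵢ xᵢ^{eᵢ}.

Monomial : ℕ → Set
Monomial N = ℤ × (Fin N → ℕ)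

Poly : ℕ → Set
Poly N = List (Monomial N)

sumFin : ∀ {A : Set} → (A → A → A) → A → (N : ℕ) → (Fin N → A) → A
sumFin _⊕_ z zero    f = z
sumFin _⊕_ z (suc N) f = f Fin.zero ⊕ sumFin _⊕_ z N (λ i → f (Fin.suc i))
  where import Data.Fin as Fin

monoDeg : ∀ {N} → Monomial N → ℕ
monoDeg {N} (c , e) = sumFin ℕ._+_ 0 N e

totalDegree : ∀ {N} → Poly N → ℕ
totalDegree []       = 0
totalDegree (m ∷ ms) = monoDeg m ⊔ totalDegree ms

module _ (R : RealField) where
  open RealField R

  evalMono : ∀ {N} → Monomial N → (Fin N → Carrier) → Carrier
  evalMono {N} (c , e) x = fromℤ c * sumFin _*_ 1# N (λ i → x i ^ e i)

  evalPoly : ∀ {N} → Poly N → (Fin N → Carrier) → Carrier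
  evalPoly []       x = 0#
  evalPoly (m ∷ ms) x = evalMono m x + evalPoly ms x

data Rel : Set where
  lt le eq ge gt : Rel

data QFFormula (N : ℕ) : Set where
  atom : Poly N → Rel → QFFormula N       -- p σ 0
  _∧ᶠ_ _∨ᶠ_ : QFFormula N → QFFormula N → QFFormula N
  ¬ᶠ_  : QFFormula N → QFFormula N

numAtoms : ∀ {N} → QFFormula N → ℕ
numAtoms (atom _ _) = 1
numAtoms (φ ∧ᶠ ψ)   = numAtoms φ ℕ.+ numAtoms ψ
numAtoms (φ ∨ᶠ ψ)   = numAtoms φ ℕ.+ numAtoms ψ
numAtoms (¬ᶠ φ)     = numAtoms φ

AtomDegree≤ : ∀ {N} → ℕ → QFFormula N → Set
AtomDegree≤ d (atom p _) = totalDegree p ℕ.≤ d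
AtomDegree≤ d (φ ∧ᶠ ψ)   = AtomDegree≤ d φ × AtomDegree≤ d ψ
AtomDegree≤ d (φ ∨ᶠ ψ)   = AtomDegree≤ d φ × AtomDegree≤ d ψ
AtomDegree≤ d (¬ᶠ φ)     = AtomDegree≤ d φ

-- ETR sentence in N variables: ∃ x₀ … x_{N-1} : φ
ETR : ℕ → Set
ETR N = QFFormula N

module _ (R : RealField) where
  open RealField R

  holdsRel : Rel → Carrier → Set
  holdsRel lt v = v < 0#
  holdsRel le v = v ≤ 0#
  holdsRel eq v = v ≡ 0#
  holdsRel ge v = 0# ≤ v
  holdsRel gt v = 0# < v

  Sat : ∀ {N} → QFFormula N → (Fin N → Carrier) → Set
  Sat (atom p σ) x = holdsRel σ (evalPoly R p x)
  Sat (φ ∧ᶠ ψ)   x = Sat φ x × Sat ψ x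
  Sat (φ ∨ᶠ ψ)   x = Sat φ x ⊎ Sat ψ x
  Sat (¬ᶠ φ)     x = ¬ Sat φ x

  TrueETR : ∀ {N} → ETR N → Set
  TrueETR φ = ∃[ x ] Sat φ x

record SimpleGraph (n m : ℕ) : Set where
  field
    edge      : Fin m → Fin n × Fin n
    loopless  : ∀ e → proj₁ (edge e) ≢ proj₂ (edge e)
    noMulti   : ∀ e f → e ≢ f →
                ¬ ((proj₁ (edge e) ≡ proj₁ (edge f) × proj₂ (edge e) ≡ proj₂ (edge f)) ⊎
                   (proj₁ (edge e) ≡ proj₂ (edge f) × proj₂ (edge e) ≡ proj₁ (edge f)))

  IncidentTo : Fin n → Fin m → Set
  IncidentTo v e = v ≡ proj₁ (edge e) ⊎ v ≡ proj₂ (edge e)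

module _ (R : RealField) where
  open RealField R

  Point : Set
  Point = Carrier × Carrier

  OnSegment : Point → Point → Point → Set
  OnSegment z p q = ∃[ t ] (0# ≤ t × t ≤ 1# ×
      proj₁ z ≡ proj₁ p + t * (proj₁ q - proj₁ p) ×
      proj₂ z ≡ proj₂ p + t * (proj₂ q - proj₂ p))

  record Drawing (n : ℕ) : Set where
    field
      pos       : Fin n → Point
      injective : ∀ u v → pos u ≡ pos v → u ≡ v

  module _ {n m : ℕ} (G : SimpleGraph n m) (Γ : Drawing n) where
    open SimpleGraph G
    open Drawing Γ

    segment₁ segment₂ : Fin m → Point
    segment₁ e = pos (proj₁ (edge e))
    segment₂ e = pos (proj₂ (edge e))

    Cross : Fin m → Fin m → Set
    Cross e f = ∃[ z ] (OnSegment z (segment₁ e) (segment₂ e) ×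
                        OnSegment z (segment₁ f) (segment₂ f) ×
                        ¬ (∃[ v ] (IncidentTo v e × IncidentTo v f × z ≡ pos v)))

  record LayerDrawing {n m : ℕ} (G : SimpleGraph n m) (ℓ : ℕ) : Set where
    field
      Γ : Drawing n
      χ : Fin m → Fin ℓ
      noMonoCrossing : ∀ e f → e ≢ f → χ e ≡ χ f → ¬ Cross G Γ e f

  HasGeometricThickness≤ : ∀ {n m} → SimpleGraph n m → ℕ → Set
  HasGeometricThickness≤ G ℓ = LayerDrawing G ℓ

{-# OPTIONS --safe #-}
-- The variables are the two coordinates of every vertex and one colour variable per edge.  The
-- formula says that vertices get distinct points, that each colour variable equals one of
-- 0, 1, …, ℓ − 1, and that no two distinct edges with equal colour variables cross.  Crossing is
-- polynomial in the endpoint coordinates: for edges without a common endpoint it is intersection of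
-- segments, decided by Cramer's rule when they are not parallel and by comparing positions on the
-- common line when they are collinear; for edges sharing an endpoint a it says that the directions
-- from a are parallel with positive inner product.  Every atom has degree at most 4.  The formula
-- has O(n² + mℓ + m²) atoms, which is O(n⁴) because m ≤ n², provided ℓ < m; for ℓ ≥ m every edge
-- can have a layer of its own and a trivially true formula does.
module Submission where

open import Level using (0ℓ)
open import Defs
open import Data.Nat as ℕ using (ℕ; zero; suc; z≤n; s≤s)
import Data.Nat.Properties as ℕ
open import Data.Integer as ℤ using (ℤ; -[1+_])
import Data.Integer.Properties as ℤ
open import Data.Sign as Sign using (Sign)
open import Data.Fin as Fin using (Fin; toℕ; _↑ˡ_; _↑ʳ_; splitAt; inject≤; combine) renaming (zero to fzero; suc to fsuc)
import Data.Fin.Properties as Fin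
open import Data.List using ([]; _∷_; _++_; map)
open import Data.List.Relation.Unary.All as All using (All; []; _∷_)
import Data.List.Relation.Unary.All.Properties as All
open import Data.Maybe using (Maybe; just; nothing)
open import Data.Product using (∃-syntax; _×_; _,_; proj₁; proj₂)
open import Data.Product.Function.NonDependent.Propositional using (_×-⇔_)
open import Data.Sum using (_⊎_; inj₁; inj₂; [_,_])
open import Data.Sum.Function.Propositional using (_⊎-⇔_)
open import Data.Empty using (⊥; ⊥-elim)
open import Function using (_∘_)
open import Function.Bundles using (_⇔_; mk⇔; Equivalence)
open import Function.Construct.Composition using (_⇔-∘_)
open import Function.Construct.Symmetry using (⇔-sym)
open import Function.Related.Propositional using (K-reflexive)
open import Function.Related.TypeIsomorphisms using (¬-cong-⇔)
open import Relation.Nullary using (¬_; Dec; yes; no)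
open import Relation.Nullary.Decidable using (_×-dec_; from-yes; decidable-stable)
open import Relation.Binary.Definitions using (tri<; tri≈; tri>)
open import Relation.Binary.PropositionalEquality hiding ([_])
open import Algebra.Bundles using (CommutativeRing)
import Algebra.Solver.Ring.AlmostCommutativeRing as ACR

module OrderedField (R : RealField) where
  open RealField R public

  commutativeRing : CommutativeRing 0ℓ 0ℓ
  commutativeRing = record { isCommutativeRing = isCommutativeRing }

  open CommutativeRing commutativeRing public
    using ( +-comm; +-assoc; *-comm; *-assoc; +-identityˡ; +-identityʳ; *-identityˡ; *-identityʳ
          ; -‿inverseʳ; zeroˡ; zeroʳ; distribˡ; distribʳ; semiring; ring )
  open import Algebra.Properties.Ring ring public
    using (-‿involutive; -0#≈0#; -‿distribˡ-*; -‿+-comm; -1*x≈-x)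
  open import Algebra.Properties.Semiring.Mult semiring using (×-homo-+; ×1-homo-*) renaming (_×_ to _×ₙ_)

  fromℕ≡×1 : ∀ k → fromℕ k ≡ k ×ₙ 1#
  fromℕ≡×1 zero    = refl
  fromℕ≡×1 (suc k) = cong (1# +_) (fromℕ≡×1 k)

  fromℕ-+ : ∀ a b → fromℕ (a ℕ.+ b) ≡ fromℕ a + fromℕ b
  fromℕ-+ a b = begin
    fromℕ (a ℕ.+ b)     ≡⟨ fromℕ≡×1 (a ℕ.+ b) ⟩
    (a ℕ.+ b) ×ₙ 1#     ≡⟨ ×-homo-+ 1# a b ⟩
    a ×ₙ 1# + b ×ₙ 1#   ≡⟨ sym (cong₂ _+_ (fromℕ≡×1 a) (fromℕ≡×1 b)) ⟩
    fromℕ a + fromℕ b   ∎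
    where open ≡-Reasoning

  fromℕ-* : ∀ a b → fromℕ (a ℕ.* b) ≡ fromℕ a * fromℕ b
  fromℕ-* a b = begin
    fromℕ (a ℕ.* b)       ≡⟨ fromℕ≡×1 (a ℕ.* b) ⟩
    (a ℕ.* b) ×ₙ 1#       ≡⟨ ×1-homo-* a b ⟩
    a ×ₙ 1# * (b ×ₙ 1#)   ≡⟨ sym (cong₂ _*_ (fromℕ≡×1 a) (fromℕ≡×1 b)) ⟩
    fromℕ a * fromℕ b     ∎
    where open ≡-Reasoning

  fromℤ-neg : ∀ i → fromℤ (ℤ.- i) ≡ - fromℤ i
  fromℤ-neg (ℤ.+ zero)  = sym -0#≈0#
  fromℤ-neg (ℤ.+ suc n) = refl
  fromℤ-neg -[1+ n ]    = sym (-‿involutive _)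

  fromℤ-⊖ : ∀ a b → fromℤ (a ℤ.⊖ b) ≡ fromℕ a - fromℕ b
  fromℤ-⊖ a       zero    = sym (trans (cong (fromℕ a +_) -0#≈0#) (+-identityʳ _))
  fromℤ-⊖ zero    (suc b) = sym (+-identityˡ _)
  fromℤ-⊖ (suc a) (suc b) = begin
    fromℤ (suc a ℤ.⊖ suc b)           ≡⟨ cong fromℤ (ℤ.[1+m]⊖[1+n]≡m⊖n a b) ⟩
    fromℤ (a ℤ.⊖ b)                   ≡⟨ fromℤ-⊖ a b ⟩
    fromℕ a - fromℕ b                 ≡⟨ sym (cancel-1 (fromℕ a) (fromℕ b)) ⟩
    (1# + fromℕ a) - (1# + fromℕ b)   ∎
    where
    open ≡-Reasoning
    cancel-1 : ∀ x y → (1# + x) - (1# + y) ≡ x - y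
    cancel-1 x y = begin
      (1# + x) + - (1# + y)     ≡⟨ cong ((1# + x) +_) (sym (-‿+-comm 1# y)) ⟩
      (1# + x) + (- 1# + - y)   ≡⟨ +-assoc 1# x _ ⟩
      1# + (x + (- 1# + - y))   ≡⟨ cong (1# +_) (trans (sym (+-assoc x _ _)) (cong (_+ - y) (+-comm x _))) ⟩
      1# + ((- 1# + x) + - y)   ≡⟨ cong (1# +_) (+-assoc _ x _) ⟩
      1# + (- 1# + (x - y))     ≡⟨ sym (+-assoc 1# _ _) ⟩
      (1# + - 1#) + (x - y)     ≡⟨ cong (_+ (x - y)) (-‿inverseʳ 1#) ⟩
      0# + (x - y)              ≡⟨ +-identityˡ _ ⟩
      x - y                     ∎

  fromℤ-+ : ∀ i j → fromℤ (i ℤ.+ j) ≡ fromℤ i + fromℤ j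
  fromℤ-+ (ℤ.+ a)  (ℤ.+ b)  = fromℕ-+ a b
  fromℤ-+ (ℤ.+ a)  -[1+ b ] = fromℤ-⊖ a (suc b)
  fromℤ-+ -[1+ a ] (ℤ.+ b)  = trans (fromℤ-⊖ b (suc a)) (+-comm _ _)
  fromℤ-+ -[1+ a ] -[1+ b ] = begin
    - (1# + (1# + fromℕ (a ℕ.+ b)))         ≡⟨ cong (λ v → - (1# + (1# + v))) (fromℕ-+ a b) ⟩
    - (1# + (1# + (fromℕ a + fromℕ b)))     ≡⟨ cong -_ (regroup (fromℕ a) (fromℕ b)) ⟩
    - ((1# + fromℕ a) + (1# + fromℕ b))     ≡⟨ sym (-‿+-comm _ _) ⟩
    - (1# + fromℕ a) + - (1# + fromℕ b)     ∎
    where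
    open ≡-Reasoning
    regroup : ∀ x y → 1# + (1# + (x + y)) ≡ (1# + x) + (1# + y)
    regroup x y = begin
      1# + (1# + (x + y))   ≡⟨ cong (1# +_) (trans (sym (+-assoc 1# x y)) (cong (_+ y) (+-comm 1# x))) ⟩
      1# + ((x + 1#) + y)   ≡⟨ cong (1# +_) (+-assoc x 1# y) ⟩
      1# + (x + (1# + y))   ≡⟨ sym (+-assoc 1# x _) ⟩
      (1# + x) + (1# + y)   ∎

  signValue : Sign → Carrier
  signValue Sign.+ = 1#
  signValue Sign.- = - 1#

  signValue-* : ∀ s t → signValue (s Sign.* t) ≡ signValue s * signValue t
  signValue-* Sign.+ t      = sym (*-identityˡ _)
  signValue-* Sign.- Sign.+ = sym (*-identityʳ _)
  signValue-* Sign.- Sign.- = sym (trans (-1*x≈-x (- 1#)) (-‿involutive 1#))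

  fromℤ-◃ : ∀ s n → fromℤ (s ℤ.◃ n) ≡ signValue s * fromℕ n
  fromℤ-◃ s      zero    = sym (zeroʳ _)
  fromℤ-◃ Sign.+ (suc n) = sym (*-identityˡ _)
  fromℤ-◃ Sign.- (suc n) = sym (-1*x≈-x _)

  fromℤ≡sign*abs : ∀ i → fromℤ i ≡ signValue (ℤ.sign i) * fromℕ ℤ.∣ i ∣
  fromℤ≡sign*abs i = trans (cong fromℤ (sym (ℤ.◃-inverse i))) (fromℤ-◃ (ℤ.sign i) ℤ.∣ i ∣)

  fromℤ-* : ∀ i j → fromℤ (i ℤ.* j) ≡ fromℤ i * fromℤ j
  fromℤ-* i j = begin
    fromℤ (i ℤ.* j)                            ≡⟨ fromℤ-◃ (ℤ.sign i Sign.* ℤ.sign j) (ℤ.∣ i ∣ ℕ.* ℤ.∣ j ∣) ⟩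
    signValue (ℤ.sign i Sign.* ℤ.sign j) * fromℕ (ℤ.∣ i ∣ ℕ.* ℤ.∣ j ∣)
                                               ≡⟨ cong₂ _*_ (signValue-* (ℤ.sign i) (ℤ.sign j)) (fromℕ-* ℤ.∣ i ∣ ℤ.∣ j ∣) ⟩
    (σ * τ) * (a * b)                          ≡⟨ interchange σ τ a b ⟩
    (σ * a) * (τ * b)                          ≡⟨ sym (cong₂ _*_ (fromℤ≡sign*abs i) (fromℤ≡sign*abs j)) ⟩
    fromℤ i * fromℤ j                          ∎
    where
    open ≡-Reasoning
    open import Algebra.Properties.CommutativeSemigroup
      (CommutativeRing.*-commutativeSemigroup commutativeRing) using (interchange)
    σ = signValue (ℤ.sign i)
    τ = signValue (ℤ.sign j)
    a = fromℕ ℤ.∣ i ∣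
    b = fromℕ ℤ.∣ j ∣

  fromℤ-morphism : ℤ.+-*-rawRing ACR.-Raw-AlmostCommutative⟶ ACR.fromCommutativeRing commutativeRing
  fromℤ-morphism = record
    { ⟦_⟧    = fromℤ
    ; +-homo = fromℤ-+
    ; *-homo = fromℤ-*
    ; -‿homo = fromℤ-neg
    ; 0-homo = refl
    ; 1-homo = +-identityʳ 1#
    }

  fromℤ-≟ : (i j : ℤ) → Maybe (fromℤ i ≡ fromℤ j)
  fromℤ-≟ i j with i ℤ.≟ j
  ... | yes i≡j = just (cong fromℤ i≡j)
  ... | no _    = nothing

  -- The solver's constant con (ℤ.+ 1) denotes 1# + 0#, not 1#, so identities involving 1# pass it
  -- to solve as a variable.
  open import Algebra.Solver.Ring ℤ.+-*-rawRing (ACR.fromCommutativeRing commutativeRing) fromℤ-morphism fromℤ-≟ public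
    using (Polynomial; con; _:+_; _:*_; _:-_; :-_; _:=_; solve)

  infix 4 _≟_
  _≟_ : (x y : Carrier) → Dec (x ≡ y)
  x ≟ y with <-total x y
  ... | inj₁ x<y        = no λ { refl → <-irrefl x x<y }
  ... | inj₂ (inj₁ x≡y) = yes x≡y
  ... | inj₂ (inj₂ y<x) = no λ { refl → <-irrefl x y<x }

  <-asym : ∀ {x y} → x < y → ¬ (y < x)
  <-asym x<y y<x = <-irrefl _ (<-trans x<y y<x)

  <⇒≢ : ∀ {x y} → x < y → x ≢ y
  <⇒≢ x<y refl = <-irrefl _ x<y

  >⇒≢ : ∀ {x y} → y < x → x ≢ y
  >⇒≢ y<x refl = <-irrefl _ y<x

  ≤-<-trans : ∀ {x y z} → x ≤ y → y < z → x < z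
  ≤-<-trans (inj₁ x<y) y<z = <-trans x<y y<z
  ≤-<-trans (inj₂ refl) y<z = y<z

  ≤⇒≯ : ∀ {x y} → x ≤ y → ¬ (y < x)
  ≤⇒≯ x≤y y<x = <-irrefl _ (≤-<-trans x≤y y<x)

  x-x≡0 : ∀ x → x - x ≡ 0#
  x-x≡0 = -‿inverseʳ

  x-y≡0⇒x≡y : ∀ {x y} → x - y ≡ 0# → x ≡ y
  x-y≡0⇒x≡y {x} {y} x-y≡0 = begin
    x                 ≡⟨ solve 2 (λ x y → x := (x :- y) :+ y) refl x y ⟩
    (x - y) + y       ≡⟨ cong (_+ y) x-y≡0 ⟩
    0# + y            ≡⟨ +-identityˡ y ⟩
    y                 ∎
    where open ≡-Reasoning

  x≡y⇒x-y≡0 : ∀ {x y} → x ≡ y → x - y ≡ 0#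
  x≡y⇒x-y≡0 {x} refl = x-x≡0 x

  x<y⇒0<y-x : ∀ {x y} → x < y → 0# < y - x
  x<y⇒0<y-x {x} x<y = subst (_< _) (x-x≡0 x) (+-mono-< (- x) x<y)

  0<y-x⇒x<y : ∀ {x y} → 0# < y - x → x < y
  0<y-x⇒x<y {x} {y} 0<y-x =
    subst₂ _<_ (+-identityˡ x) (solve 2 (λ y x → (y :- x) :+ x := y) refl y x) (+-mono-< x 0<y-x)

  x<y⇒x-y<0 : ∀ {x y} → x < y → x - y < 0#
  x<y⇒x-y<0 {x} {y} x<y = subst (x - y <_) (x-x≡0 y) (+-mono-< (- y) x<y)

  x≤y⇒0≤y-x : ∀ {x y} → x ≤ y → 0# ≤ y - x
  x≤y⇒0≤y-x (inj₁ x<y) = inj₁ (x<y⇒0<y-x x<y)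
  x≤y⇒0≤y-x {x} (inj₂ refl) = inj₂ (sym (x-x≡0 x))

  0≤y-x⇒x≤y : ∀ {x y} → 0# ≤ y - x → x ≤ y
  0≤y-x⇒x≤y (inj₁ 0<y-x) = inj₁ (0<y-x⇒x<y 0<y-x)
  0≤y-x⇒x≤y (inj₂ 0≡y-x) = inj₂ (sym (x-y≡0⇒x≡y (sym 0≡y-x)))

  0<x⇒-x<0 : ∀ {x} → 0# < x → - x < 0#
  0<x⇒-x<0 {x} 0<x = subst₂ _<_ (+-identityˡ (- x)) (x-x≡0 x) (+-mono-< (- x) 0<x)

  x<0⇒0<-x : ∀ {x} → x < 0# → 0# < - x
  x<0⇒0<-x {x} x<0 = subst₂ _<_ (x-x≡0 x) (+-identityˡ (- x)) (+-mono-< (- x) x<0)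

  +-pos-nonneg : ∀ {x y} → 0# < x → 0# ≤ y → 0# < x + y
  +-pos-nonneg {x} {y} 0<x 0≤y = ≤-<-trans 0≤y (subst (_< x + y) (+-identityˡ y) (+-mono-< y 0<x))

  +-nonneg : ∀ {x y} → 0# ≤ x → 0# ≤ y → 0# ≤ x + y
  +-nonneg (inj₁ 0<x) 0≤y = inj₁ (+-pos-nonneg 0<x 0≤y)
  +-nonneg {y = y} (inj₂ refl) 0≤y = subst (0# ≤_) (sym (+-identityˡ y)) 0≤y

  *-nonneg : ∀ {x y} → 0# ≤ x → 0# ≤ y → 0# ≤ x * y
  *-nonneg (inj₁ 0<x) (inj₁ 0<y) = inj₁ (*-pos 0<x 0<y)
  *-nonneg {x} (inj₁ _) (inj₂ refl) = inj₂ (sym (zeroʳ x))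
  *-nonneg {y = y} (inj₂ refl) _ = inj₂ (sym (zeroˡ y))

  *-neg-neg : ∀ {x y} → x < 0# → y < 0# → 0# < x * y
  *-neg-neg {x} {y} x<0 y<0 =
    subst (0# <_) (solve 2 (λ x y → (:- x) :* (:- y) := x :* y) refl x y) (*-pos (x<0⇒0<-x x<0) (x<0⇒0<-x y<0))

  square-pos : ∀ {x} → x ≢ 0# → 0# < x * x
  square-pos {x} x≢0 with <-total x 0#
  ... | inj₁ x<0        = *-neg-neg x<0 x<0
  ... | inj₂ (inj₁ x≡0) = ⊥-elim (x≢0 x≡0)
  ... | inj₂ (inj₂ 0<x) = *-pos 0<x 0<x

  square-nonneg : ∀ x → 0# ≤ x * x
  square-nonneg x with x ≟ 0#
  ... | yes refl = inj₂ (sym (zeroˡ 0#))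
  ... | no x≢0   = inj₁ (square-pos x≢0)

  0<1 : 0# < 1#
  0<1 = subst (0# <_) (*-identityʳ 1#) (square-pos (λ 1≡0 → 0≢1 (sym 1≡0)))

  *-cancelˡ-0 : ∀ {x y} → x ≢ 0# → x * y ≡ 0# → y ≡ 0#
  *-cancelˡ-0 {x} {y} x≢0 xy≡0 with inverse x x≢0
  ... | x⁻¹ , xx⁻¹≡1 = begin
    y                ≡⟨ sym (*-identityʳ y) ⟩
    y * 1#           ≡⟨ cong (y *_) (sym xx⁻¹≡1) ⟩
    y * (x * x⁻¹)    ≡⟨ solve 3 (λ x x⁻¹ y → y :* (x :* x⁻¹) := x⁻¹ :* (x :* y)) refl x x⁻¹ y ⟩
    x⁻¹ * (x * y)    ≡⟨ cong (x⁻¹ *_) xy≡0 ⟩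
    x⁻¹ * 0#         ≡⟨ zeroʳ x⁻¹ ⟩
    0#               ∎
    where open ≡-Reasoning

  pos-*-cancelˡ : ∀ {x y} → 0# < x → 0# < x * y → 0# < y
  pos-*-cancelˡ {x} {y} 0<x 0<xy with <-total y 0#
  ... | inj₁ y<0 = ⊥-elim (<-asym 0<xy (subst (_< 0#) (solve 2 (λ x y → :- (x :* (:- y)) := x :* y) refl x y)
                                                  (0<x⇒-x<0 (*-pos 0<x (x<0⇒0<-x y<0)))))
  ... | inj₂ (inj₁ refl) = ⊥-elim (<⇒≢ 0<xy (sym (zeroʳ x)))
  ... | inj₂ (inj₂ 0<y) = 0<y

  inverse-pos : ∀ {x x⁻¹} → 0# < x → x * x⁻¹ ≡ 1# → 0# < x⁻¹
  inverse-pos 0<x xx⁻¹≡1 = pos-*-cancelˡ 0<x (subst (0# <_) (sym xx⁻¹≡1) 0<1)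

  -- x + s y = (1 − s) x + s (x + y)
  convex-pos : ∀ {s x y} → 0# ≤ s → s ≤ 1# → 0# < x → 0# < x + y → 0# < x + s * y
  convex-pos {s} {x} {y} 0≤s (inj₁ s<1) 0<x 0<x+y = subst (0# <_) combination
    (+-pos-nonneg (*-pos (x<y⇒0<y-x s<1) 0<x) (*-nonneg 0≤s (inj₁ 0<x+y)))
    where
    combination : (1# - s) * x + s * (x + y) ≡ x + s * y
    combination = trans (solve 4 (λ s x y o → (o :- s) :* x :+ s :* (x :+ y) := o :* x :+ s :* y) refl s x y 1#)
                        (cong (_+ s * y) (*-identityˡ x))
  convex-pos {x = x} {y} _ (inj₂ refl) _ 0<x+y = subst (λ v → 0# < x + v) (sym (*-identityˡ y)) 0<x+y

  fromℕ-nonneg : ∀ k → 0# ≤ fromℕ k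
  fromℕ-nonneg zero    = inj₂ refl
  fromℕ-nonneg (suc k) = inj₁ (+-pos-nonneg 0<1 (fromℕ-nonneg k))

  fromℕ-< : ∀ {a b} → a ℕ.< b → fromℕ a < fromℕ b
  fromℕ-< {zero}  {suc b} _         = +-pos-nonneg 0<1 (fromℕ-nonneg b)
  fromℕ-< {suc a} {suc b} (s≤s a<b) = subst₂ _<_ (+-comm _ 1#) (+-comm _ 1#) (+-mono-< 1# (fromℕ-< a<b))

  fromℕ-injective : ∀ {a b} → fromℕ a ≡ fromℕ b → a ≡ b
  fromℕ-injective {a} {b} fa≡fb with ℕ.<-cmp a b
  ... | tri< a<b _ _ = ⊥-elim (<⇒≢ (fromℕ-< a<b) fa≡fb)
  ... | tri≈ _ a≡b _ = a≡b
  ... | tri> _ _ b<a = ⊥-elim (>⇒≢ (fromℕ-< b<a) fa≡fb)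

infixl 6 _⊕_ _⊖_
infixl 7 _⊗_
infix  8 ⊝_

data Expr (N : ℕ) : Set where
  var     : Fin N → Expr N
  lit     : ℤ → Expr N
  _⊕_ _⊗_ : Expr N → Expr N → Expr N
  ⊝_      : Expr N → Expr N

_⊖_ : ∀ {N} → Expr N → Expr N → Expr N
a ⊖ b = a ⊕ ⊝ b

degree : ∀ {N} → Expr N → ℕ
degree (var i) = 1
degree (lit c) = 0
degree (a ⊕ b) = degree a ℕ.⊔ degree b
degree (a ⊗ b) = degree a ℕ.+ degree b
degree (⊝ a)   = degree a

unitExponent : ∀ {N} → Fin N → Fin N → ℕ
unitExponent fzero    fzero    = 1
unitExponent fzero    (fsuc j) = 0
unitExponent (fsuc i) fzero    = 0
unitExponent (fsuc i) (fsuc j) = unitExponent i j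

_·ₘ_ : ∀ {N} → Monomial N → Monomial N → Monomial N
(c , e) ·ₘ (d , f) = (c ℤ.* d , λ i → e i ℕ.+ f i)

negateₘ : ∀ {N} → Monomial N → Monomial N
negateₘ (c , e) = (ℤ.- c , e)

_·ₚ_ : ∀ {N} → Poly N → Poly N → Poly N
[]       ·ₚ q = []
(μ ∷ p) ·ₚ q = map (μ ·ₘ_) q ++ (p ·ₚ q)

expand : ∀ {N} → Expr N → Poly N
expand (var i) = (ℤ.+ 1 , unitExponent i) ∷ []
expand (lit c) = (c , λ _ → 0) ∷ []
expand (a ⊕ b) = expand a ++ expand b
expand (a ⊗ b) = expand a ·ₚ expand b
expand (⊝ a)   = map negateₘ (expand a)

expSum : ∀ N → (Fin N → ℕ) → ℕ
expSum = sumFin ℕ._+_ 0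

expSum-+ : ∀ N (e f : Fin N → ℕ) → expSum N (λ i → e i ℕ.+ f i) ≡ expSum N e ℕ.+ expSum N f
expSum-+ zero    e f = refl
expSum-+ (suc N) e f =
  trans (cong (e fzero ℕ.+ f fzero ℕ.+_) (expSum-+ N (λ i → e (fsuc i)) (λ i → f (fsuc i)))) (interchange (e fzero) (f fzero) _ _)
  where open import Algebra.Properties.CommutativeSemigroup ℕ.+-commutativeSemigroup using (interchange)

expSum-zero : ∀ N → expSum N (λ _ → 0) ≡ 0
expSum-zero zero    = refl
expSum-zero (suc N) = expSum-zero N

expSum-unit : ∀ N (i : Fin N) → expSum N (unitExponent i) ≡ 1
expSum-unit (suc N) fzero    = cong suc (expSum-zero N)
expSum-unit (suc N) (fsuc i) = expSum-unit N i

DegreesBelow : ∀ {N} → ℕ → Poly N → Set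
DegreesBelow d = All (λ μ → monoDeg μ ℕ.≤ d)

totalDegree≤ : ∀ {N d} (p : Poly N) → DegreesBelow d p → totalDegree p ℕ.≤ d
totalDegree≤ []      []       = z≤n
totalDegree≤ (μ ∷ p) (μ≤d ∷ p≤d) = ℕ.⊔-lub μ≤d (totalDegree≤ p p≤d)

degreesBelow-·ₚ : ∀ {N d d′} (p q : Poly N) → DegreesBelow d p → DegreesBelow d′ q → DegreesBelow (d ℕ.+ d′) (p ·ₚ q)
degreesBelow-·ₚ {N} []            q []          _   = []
degreesBelow-·ₚ {N} ((c , e) ∷ p) q (μ≤d ∷ p≤d) q≤d′ =
  All.++⁺ (All.map⁺ (All.map (λ {(_ , f)} ν≤d′ → subst (ℕ._≤ _) (sym (expSum-+ N e f)) (ℕ.+-mono-≤ μ≤d ν≤d′)) q≤d′))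
          (degreesBelow-·ₚ p q p≤d q≤d′)

degreesBelow-expand : ∀ {N} (a : Expr N) → DegreesBelow (degree a) (expand a)
degreesBelow-expand {N} (var i) = ℕ.≤-reflexive (expSum-unit N i) ∷ []
degreesBelow-expand {N} (lit c) = ℕ.≤-reflexive (expSum-zero N) ∷ []
degreesBelow-expand (a ⊕ b) = All.++⁺ (All.map (λ μ≤ → ℕ.≤-trans μ≤ (ℕ.m≤m⊔n (degree a) (degree b))) (degreesBelow-expand a))
                                      (All.map (λ μ≤ → ℕ.≤-trans μ≤ (ℕ.m≤n⊔m (degree a) (degree b))) (degreesBelow-expand b))
degreesBelow-expand (a ⊗ b) = degreesBelow-·ₚ (expand a) (expand b) (degreesBelow-expand a) (degreesBelow-expand b)
degreesBelow-expand (⊝ a)   = All.map⁺ (degreesBelow-expand a)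

totalDegree-expand : ∀ {N} (a : Expr N) → totalDegree (expand a) ℕ.≤ degree a
totalDegree-expand a = totalDegree≤ (expand a) (degreesBelow-expand a)

module ExprSemantics (R : RealField) where
  open OrderedField R

  ⟦_⟧ : ∀ {N} → Expr N → (Fin N → Carrier) → Carrier
  ⟦ var i ⟧ x = x i
  ⟦ lit c ⟧ x = fromℤ c
  ⟦ a ⊕ b ⟧ x = ⟦ a ⟧ x + ⟦ b ⟧ x
  ⟦ a ⊗ b ⟧ x = ⟦ a ⟧ x * ⟦ b ⟧ x
  ⟦ ⊝ a ⟧   x = - ⟦ a ⟧ x

  product : ∀ N → (Fin N → Carrier) → Carrier
  product = sumFin _*_ 1#

  product-cong : ∀ N {g h : Fin N → Carrier} → (∀ i → g i ≡ h i) → product N g ≡ product N h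
  product-cong zero    g≗h = refl
  product-cong (suc N) g≗h = cong₂ _*_ (g≗h fzero) (product-cong N (λ i → g≗h (fsuc i)))

  product-* : ∀ N (g h : Fin N → Carrier) → product N (λ i → g i * h i) ≡ product N g * product N h
  product-* zero    g h = sym (*-identityʳ 1#)
  product-* (suc N) g h =
    trans (cong (g fzero * h fzero *_) (product-* N (λ i → g (fsuc i)) (λ i → h (fsuc i)))) (interchange (g fzero) (h fzero) _ _)
    where open import Algebra.Properties.CommutativeSemigroup (CommutativeRing.*-commutativeSemigroup commutativeRing) using (interchange)

  product-one : ∀ N → product N (λ _ → 1#) ≡ 1#
  product-one zero    = refl
  product-one (suc N) = trans (*-identityˡ _) (product-one N)

  product-unit : ∀ N (x : Fin N → Carrier) i → product N (λ j → x j ^ unitExponent i j) ≡ x i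
  product-unit (suc N) x fzero    = trans (cong₂ _*_ (*-identityʳ (x fzero)) (product-one N)) (*-identityʳ _)
  product-unit (suc N) x (fsuc i) = trans (*-identityˡ _) (product-unit N (λ j → x (fsuc j)) i)

  ^-+ : ∀ y a b → y ^ (a ℕ.+ b) ≡ y ^ a * y ^ b
  ^-+ y zero    b = sym (*-identityˡ _)
  ^-+ y (suc a) b = trans (cong (y *_) (^-+ y a b)) (sym (*-assoc y _ _))

  evalPoly-++ : ∀ {N} (p q : Poly N) x → evalPoly R (p ++ q) x ≡ evalPoly R p x + evalPoly R q x
  evalPoly-++ []      q x = sym (+-identityˡ _)
  evalPoly-++ (μ ∷ p) q x = trans (cong (evalMono R μ x +_) (evalPoly-++ p q x)) (sym (+-assoc _ _ _))

  evalMono-·ₘ : ∀ {N} (μ ν : Monomial N) x → evalMono R (μ ·ₘ ν) x ≡ evalMono R μ x * evalMono R ν x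
  evalMono-·ₘ {N} (c , e) (d , f) x = begin
    fromℤ (c ℤ.* d) * product N (λ i → x i ^ (e i ℕ.+ f i))
      ≡⟨ cong₂ _*_ (fromℤ-* c d) (trans (product-cong N (λ i → ^-+ (x i) (e i) (f i))) (product-* N _ _)) ⟩
    (fromℤ c * fromℤ d) * (product N (λ i → x i ^ e i) * product N (λ i → x i ^ f i))
      ≡⟨ interchange _ _ _ _ ⟩
    (fromℤ c * product N (λ i → x i ^ e i)) * (fromℤ d * product N (λ i → x i ^ f i))   ∎
    where
    open ≡-Reasoning
    open import Algebra.Properties.CommutativeSemigroup (CommutativeRing.*-commutativeSemigroup commutativeRing) using (interchange)

  evalPoly-·ₚ : ∀ {N} (p q : Poly N) x → evalPoly R (p ·ₚ q) x ≡ evalPoly R p x * evalPoly R q x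
  evalPoly-·ₚ []      q x = sym (zeroˡ _)
  evalPoly-·ₚ (μ ∷ p) q x = begin
    evalPoly R (map (μ ·ₘ_) q ++ (p ·ₚ q)) x                     ≡⟨ evalPoly-++ (map (μ ·ₘ_) q) (p ·ₚ q) x ⟩
    evalPoly R (map (μ ·ₘ_) q) x + evalPoly R (p ·ₚ q) x          ≡⟨ cong₂ _+_ (scale q) (evalPoly-·ₚ p q x) ⟩
    evalMono R μ x * evalPoly R q x + evalPoly R p x * evalPoly R q x   ≡⟨ sym (distribʳ _ _ _) ⟩
    (evalMono R μ x + evalPoly R p x) * evalPoly R q x           ∎
    where
    open ≡-Reasoning
    scale : ∀ q → evalPoly R (map (μ ·ₘ_) q) x ≡ evalMono R μ x * evalPoly R q x
    scale []      = sym (zeroʳ _)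
    scale (ν ∷ q) = trans (cong₂ _+_ (evalMono-·ₘ μ ν x) (scale q)) (sym (distribˡ _ _ _))

  evalPoly-negate : ∀ {N} (p : Poly N) x → evalPoly R (map negateₘ p) x ≡ - evalPoly R p x
  evalPoly-negate []            x = sym -0#≈0#
  evalPoly-negate {N} ((c , e) ∷ p) x =
    trans (cong₂ _+_ (trans (cong (_* product N (λ i → x i ^ e i)) (fromℤ-neg c)) (sym (-‿distribˡ-* _ _))) (evalPoly-negate p x))
          (-‿+-comm _ _)

  evalPoly-expand : ∀ {N} (a : Expr N) x → evalPoly R (expand a) x ≡ ⟦ a ⟧ x
  evalPoly-expand {N} (var i) x = begin
    fromℤ (ℤ.+ 1) * product N (λ j → x j ^ unitExponent i j) + 0#   ≡⟨ +-identityʳ _ ⟩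
    (1# + 0#) * product N (λ j → x j ^ unitExponent i j)             ≡⟨ cong₂ _*_ (+-identityʳ 1#) (product-unit N x i) ⟩
    1# * x i                                                         ≡⟨ *-identityˡ (x i) ⟩
    x i                                                              ∎
    where open ≡-Reasoning
  evalPoly-expand {N} (lit c) x = trans (+-identityʳ _) (trans (cong (fromℤ c *_) (product-one N)) (*-identityʳ _))
  evalPoly-expand (a ⊕ b) x = trans (evalPoly-++ (expand a) (expand b) x) (cong₂ _+_ (evalPoly-expand a x) (evalPoly-expand b x))
  evalPoly-expand (a ⊗ b) x = trans (evalPoly-·ₚ (expand a) (expand b) x) (cong₂ _*_ (evalPoly-expand a x) (evalPoly-expand b x))
  evalPoly-expand (⊝ a)   x = trans (evalPoly-negate (expand a) x) (cong -_ (evalPoly-expand a x))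

infixr 3 _∧ₑ_
infixr 2 _∨ₑ_
infix  4 ¬ₑ_

data Formula (N : ℕ) : Set where
  atomₑ     : Expr N → Rel → Formula N
  _∧ₑ_ _∨ₑ_ : Formula N → Formula N → Formula N
  ¬ₑ_       : Formula N → Formula N

compile : ∀ {N} → Formula N → QFFormula N
compile (atomₑ a ρ) = atom (expand a) ρ
compile (φ ∧ₑ ψ)    = compile φ ∧ᶠ compile ψ
compile (φ ∨ₑ ψ)    = compile φ ∨ᶠ compile ψ
compile (¬ₑ φ)      = ¬ᶠ compile φ

DegreeBound : ∀ {N} → ℕ → Formula N → Set
DegreeBound d (atomₑ a _) = degree a ℕ.≤ d
DegreeBound d (φ ∧ₑ ψ)    = DegreeBound d φ × DegreeBound d ψ
DegreeBound d (φ ∨ₑ ψ)    = DegreeBound d φ × DegreeBound d ψ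
DegreeBound d (¬ₑ φ)      = DegreeBound d φ

degreeBound? : ∀ {N} d (φ : Formula N) → Dec (DegreeBound d φ)
degreeBound? d (atomₑ a _) = degree a ℕ.≤? d
degreeBound? d (φ ∧ₑ ψ)    = degreeBound? d φ ×-dec degreeBound? d ψ
degreeBound? d (φ ∨ₑ ψ)    = degreeBound? d φ ×-dec degreeBound? d ψ
degreeBound? d (¬ₑ φ)      = degreeBound? d φ

atomDegree-compile : ∀ {N d} (φ : Formula N) → DegreeBound d φ → AtomDegree≤ d (compile φ)
atomDegree-compile (atomₑ a _) a≤d         = ℕ.≤-trans (totalDegree-expand a) a≤d
atomDegree-compile (φ ∧ₑ ψ)    (φ≤d , ψ≤d) = atomDegree-compile φ φ≤d , atomDegree-compile ψ ψ≤d
atomDegree-compile (φ ∨ₑ ψ)    (φ≤d , ψ≤d) = atomDegree-compile φ φ≤d , atomDegree-compile ψ ψ≤d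
atomDegree-compile (¬ₑ φ)      φ≤d         = atomDegree-compile φ φ≤d

size : ∀ {N} → Formula N → ℕ
size φ = numAtoms (compile φ)

trueₑ : ∀ {N} → Formula N
trueₑ = atomₑ (lit (ℤ.+ 0)) eq

⋀ ⋁ : ∀ {N} k → (Fin k → Formula N) → Formula N
⋀ zero    f = trueₑ
⋀ (suc k) f = f fzero ∧ₑ ⋀ k (f ∘ fsuc)
⋁ zero    f = ¬ₑ trueₑ
⋁ (suc k) f = f fzero ∨ₑ ⋁ k (f ∘ fsuc)

unless : ∀ {N} {P : Set} → Dec P → Formula N → Formula N
unless (yes _) φ = trueₑ
unless (no _)  φ = φ

size-step : ∀ {a b} k B → a ℕ.≤ B → b ℕ.≤ k ℕ.* B ℕ.+ 1 → a ℕ.+ b ℕ.≤ suc k ℕ.* B ℕ.+ 1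
size-step {a} {b} k B a≤B b≤ = subst (a ℕ.+ b ℕ.≤_) (sym (ℕ.+-assoc B (k ℕ.* B) 1)) (ℕ.+-mono-≤ a≤B b≤)

size-⋀ : ∀ {N} k (f : Fin k → Formula N) {B} → (∀ i → size (f i) ℕ.≤ B) → size (⋀ k f) ℕ.≤ k ℕ.* B ℕ.+ 1
size-⋀ zero    f      _ = ℕ.≤-refl
size-⋀ (suc k) f {B} f≤B = size-step k B (f≤B fzero) (size-⋀ k (f ∘ fsuc) (f≤B ∘ fsuc))

size-⋁ : ∀ {N} k (f : Fin k → Formula N) {B} → (∀ i → size (f i) ℕ.≤ B) → size (⋁ k f) ℕ.≤ k ℕ.* B ℕ.+ 1
size-⋁ zero    f      _ = ℕ.≤-refl
size-⋁ (suc k) f {B} f≤B = size-step k B (f≤B fzero) (size-⋁ k (f ∘ fsuc) (f≤B ∘ fsuc))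

size-unless : ∀ {N P B} (d : Dec P) {φ : Formula N} → 1 ℕ.≤ B → size φ ℕ.≤ B → size (unless d φ) ℕ.≤ B
size-unless (yes _) 1≤B _   = 1≤B
size-unless (no _)  _   φ≤B = φ≤B

degreeBound-⋀ : ∀ {N d} k (f : Fin k → Formula N) → (∀ i → DegreeBound d (f i)) → DegreeBound d (⋀ k f)
degreeBound-⋀ zero    f _   = z≤n
degreeBound-⋀ (suc k) f f≤d = f≤d fzero , degreeBound-⋀ k (f ∘ fsuc) (f≤d ∘ fsuc)

degreeBound-⋁ : ∀ {N d} k (f : Fin k → Formula N) → (∀ i → DegreeBound d (f i)) → DegreeBound d (⋁ k f)
degreeBound-⋁ zero    f _   = z≤n
degreeBound-⋁ (suc k) f f≤d = f≤d fzero , degreeBound-⋁ k (f ∘ fsuc) (f≤d ∘ fsuc)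

degreeBound-unless : ∀ {N P d} (p? : Dec P) {φ : Formula N} → DegreeBound d φ → DegreeBound d (unless p? φ)
degreeBound-unless (yes _) _   = z≤n
degreeBound-unless (no _)  φ≤d = φ≤d

module FormulaSemantics (R : RealField) where
  open OrderedField R
  open ExprSemantics R

  Holds : ∀ {N} → Formula N → (Fin N → Carrier) → Set
  Holds (atomₑ a ρ) x = holdsRel R ρ (⟦ a ⟧ x)
  Holds (φ ∧ₑ ψ)    x = Holds φ x × Holds ψ x
  Holds (φ ∨ₑ ψ)    x = Holds φ x ⊎ Holds ψ x
  Holds (¬ₑ φ)      x = ¬ Holds φ x

  Sat-compile : ∀ {N} (φ : Formula N) x → Sat R (compile φ) x ⇔ Holds φ x
  Sat-compile (atomₑ a ρ) x = mk⇔ (subst (holdsRel R ρ) (evalPoly-expand a x)) (subst (holdsRel R ρ) (sym (evalPoly-expand a x)))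
  Sat-compile (φ ∧ₑ ψ)    x = Sat-compile φ x ×-⇔ Sat-compile ψ x
  Sat-compile (φ ∨ₑ ψ)    x = Sat-compile φ x ⊎-⇔ Sat-compile ψ x
  Sat-compile (¬ₑ φ)      x = ¬-cong-⇔ (Sat-compile φ x)

  Holds-⋀ : ∀ {N} k (f : Fin k → Formula N) x → Holds (⋀ k f) x ⇔ (∀ i → Holds (f i) x)
  Holds-⋀ zero    f x = mk⇔ (λ _ ()) (λ _ → refl)
  Holds-⋀ (suc k) f x = mk⇔ to (λ h → h fzero , Equivalence.from (Holds-⋀ k (f ∘ fsuc) x) (h ∘ fsuc))
    where
    to : Holds (⋀ (suc k) f) x → ∀ i → Holds (f i) x
    to (h , _)  fzero    = h
    to (_ , hs) (fsuc i) = Equivalence.to (Holds-⋀ k (f ∘ fsuc) x) hs i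

  Holds-⋁ : ∀ {N} k (f : Fin k → Formula N) x → Holds (⋁ k f) x ⇔ (∃[ i ] Holds (f i) x)
  Holds-⋁ zero    f x = mk⇔ (λ h → ⊥-elim (h refl)) (λ ())
  Holds-⋁ (suc k) f x = mk⇔ to from
    where
    to : Holds (⋁ (suc k) f) x → ∃[ i ] Holds (f i) x
    to (inj₁ h)  = fzero , h
    to (inj₂ hs) = let (i , h) = Equivalence.to (Holds-⋁ k (f ∘ fsuc) x) hs in fsuc i , h
    from : ∃[ i ] Holds (f i) x → Holds (⋁ (suc k) f) x
    from (fzero , h)  = inj₁ h
    from (fsuc i , h) = inj₂ (Equivalence.from (Holds-⋁ k (f ∘ fsuc) x) (i , h))

  Holds-unless : ∀ {N P} (p? : Dec P) (φ : Formula N) x → Holds (unless p? φ) x ⇔ (¬ P → Holds φ x)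
  Holds-unless (yes p) φ x = mk⇔ (λ _ ¬p → ⊥-elim (¬p p)) (λ _ → refl)
  Holds-unless (no ¬p) φ x = mk⇔ (λ h _ → h) (λ h → h ¬p)

module Geometry (R : RealField) where
  open OrderedField R
  open import Algebra.Properties.Group (CommutativeRing.+-group commutativeRing)
    using () renaming (∙-cancelˡ to +-cancelˡ)

  infixl 6 _−ᵥ_
  _−ᵥ_ : Point R → Point R → Point R
  q −ᵥ p = (proj₁ q - proj₁ p , proj₂ q - proj₂ p)

  cross dot : Point R → Point R → Carrier
  cross u w = (proj₁ u * proj₂ w) - (proj₂ u * proj₁ w)
  dot   u w = proj₁ u * proj₁ w + proj₂ u * proj₂ w

  crossₚ dotₚ : ∀ {k} → Polynomial k → Polynomial k → Polynomial k → Polynomial k → Polynomial k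
  crossₚ u₁ u₂ w₁ w₂ = u₁ :* w₂ :- u₂ :* w₁
  dotₚ   u₁ u₂ w₁ w₂ = u₁ :* w₁ :+ u₂ :* w₂

  dot-self-pos : ∀ {p q} → p ≢ q → 0# < dot (q −ᵥ p) (q −ᵥ p)
  dot-self-pos {p} {q} p≢q with proj₁ q - proj₁ p ≟ 0# | proj₂ q - proj₂ p ≟ 0#
  ... | no u₁≢0 | _       = +-pos-nonneg (square-pos u₁≢0) (square-nonneg _)
  ... | yes _   | no u₂≢0 = subst (0# <_) (+-comm _ _) (+-pos-nonneg (square-pos u₂≢0) (square-nonneg _))
  ... | yes u₁≡0 | yes u₂≡0 = ⊥-elim (p≢q (sym (cong₂ _,_ (x-y≡0⇒x≡y u₁≡0) (x-y≡0⇒x≡y u₂≡0))))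

  drop-zero-term : ∀ {x k y} → k ≡ 0# → x + k * y ≡ x
  drop-zero-term {x} {y = y} refl = trans (cong (x +_) (zeroˡ y)) (+-identityʳ x)

  drop-zero-term⁻ : ∀ {x k y} → k ≡ 0# → x - (k * y) ≡ x
  drop-zero-term⁻ {x} {y = y} refl = trans (cong (λ v → x - v) (zeroˡ y)) (trans (cong (x +_) -0#≈0#) (+-identityʳ x))

  AtParameter : Point R → Point R → Point R → Carrier → Set
  AtParameter z p q t = proj₁ z ≡ proj₁ p + t * (proj₁ q - proj₁ p) × proj₂ z ≡ proj₂ p + t * (proj₂ q - proj₂ p)

  atParameter-zero : ∀ {z p q} → AtParameter z p q 0# → z ≡ p
  atParameter-zero (z₁ , z₂) = cong₂ _,_ (trans z₁ (drop-zero-term refl)) (trans z₂ (drop-zero-term refl))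

  onSegment-start : ∀ p q → OnSegment R p p q
  onSegment-start p q = 0# , inj₂ refl , inj₁ 0<1 , sym (drop-zero-term refl) , sym (drop-zero-term refl)

  onSegment-end : ∀ p q → OnSegment R q p q
  onSegment-end p q = 1# , inj₁ 0<1 , inj₂ refl , end (proj₁ p) (proj₁ q) , end (proj₂ p) (proj₂ q)
    where
    end : ∀ a b → b ≡ a + 1# * (b - a)
    end a b = sym (trans (cong (a +_) (*-identityˡ (b - a))) (solve 2 (λ a b → a :+ (b :- a) := b) refl a b))

  onSegment-sym : ∀ {z p q} → OnSegment R z p q → OnSegment R z q p
  onSegment-sym {z} {p} {q} (t , 0≤t , t≤1 , z₁ , z₂) =
    1# - t , x≤y⇒0≤y-x t≤1 , 0≤y-x⇒x≤y (subst (0# ≤_) (sym 1-[1-t]≡t) 0≤t) , trans z₁ (reverse _ _) , trans z₂ (reverse _ _)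
    where
    1-[1-t]≡t : 1# - (1# - t) ≡ t
    1-[1-t]≡t = solve 2 (λ o t → o :- (o :- t) := t) refl 1# t
    reverse : ∀ a b → a + t * (b - a) ≡ b + (1# - t) * (a - b)
    reverse a b = begin
      a + t * (b - a)                         ≡⟨ solve 4 (λ o t a b → a :+ t :* (b :- a) := b :+ (o :- t) :* (a :- b) :+ ((a :- b) :- o :* (a :- b))) refl 1# t a b ⟩
      b + (1# - t) * (a - b) + ((a - b) - (1# * (a - b)))
                                              ≡⟨ cong (λ v → b + (1# - t) * (a - b) + ((a - b) - v)) (*-identityˡ (a - b)) ⟩
      b + (1# - t) * (a - b) + ((a - b) - (a - b))
                                              ≡⟨ trans (cong (b + (1# - t) * (a - b) +_) (x-x≡0 (a - b))) (+-identityʳ _) ⟩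
      b + (1# - t) * (a - b)                  ∎
      where open ≡-Reasoning

  SegmentsMeet : Point R → Point R → Point R → Point R → Set
  SegmentsMeet a b c d = ∃[ z ] (OnSegment R z a b × OnSegment R z c d)

  OverlapBeyond : Point R → Point R → Point R → Set
  OverlapBeyond a b d = ∃[ z ] (OnSegment R z a b × OnSegment R z a d × z ≢ a)

  -- x / y ∈ [0, 1], written without division
  InUnitRatio : Carrier → Carrier → Set
  InUnitRatio x y = 0# ≤ x * y × 0# ≤ (y * y) - (x * y)

  inUnitRatio-scaled : ∀ {t y} → 0# ≤ t → t ≤ 1# → InUnitRatio (t * y) y
  inUnitRatio-scaled {t} {y} 0≤t t≤1 =
      subst (0# ≤_) (sym (*-assoc t y y)) (*-nonneg 0≤t (square-nonneg y))
    , subst (0# ≤_) rest (*-nonneg (x≤y⇒0≤y-x t≤1) (square-nonneg y))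
    where
    rest : (1# - t) * (y * y) ≡ (y * y) - ((t * y) * y)
    rest = trans (solve 3 (λ o t y → (o :- t) :* (y :* y) := o :* (y :* y) :- (t :* y) :* y) refl 1# t y)
                 (cong (λ v → v - ((t * y) * y)) (*-identityˡ (y * y)))

  inUnitRatio-between : ∀ {x y} → 0# ≤ y → 0# ≤ x → 0# ≤ y - x → InUnitRatio x y
  inUnitRatio-between {x} {y} 0≤y 0≤x 0≤y-x =
    *-nonneg 0≤x 0≤y , subst (0# ≤_) (solve 2 (λ x y → (y :- x) :* y := y :* y :- x :* y) refl x y) (*-nonneg 0≤y-x 0≤y)

  inUnitRatio⇒unit : ∀ {x y y⁻¹} → y * y⁻¹ ≡ 1# → InUnitRatio x y → 0# ≤ x * y⁻¹ × x * y⁻¹ ≤ 1#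
  inUnitRatio⇒unit {x} {y} {y⁻¹} yy⁻¹≡1 (0≤xy , 0≤yy-xy) =
      subst (0# ≤_) lower (*-nonneg 0≤xy (square-nonneg y⁻¹))
    , 0≤y-x⇒x≤y (subst (0# ≤_) upper (*-nonneg 0≤yy-xy (square-nonneg y⁻¹)))
    where
    lower : (x * y) * (y⁻¹ * y⁻¹) ≡ x * y⁻¹
    lower = begin
      (x * y) * (y⁻¹ * y⁻¹)     ≡⟨ solve 3 (λ x y y⁻¹ → (x :* y) :* (y⁻¹ :* y⁻¹) := (x :* y⁻¹) :* (y :* y⁻¹)) refl x y y⁻¹ ⟩
      (x * y⁻¹) * (y * y⁻¹)     ≡⟨ cong ((x * y⁻¹) *_) yy⁻¹≡1 ⟩
      (x * y⁻¹) * 1#            ≡⟨ *-identityʳ _ ⟩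
      x * y⁻¹                   ∎
      where open ≡-Reasoning
    upper : ((y * y) - (x * y)) * (y⁻¹ * y⁻¹) ≡ 1# - (x * y⁻¹)
    upper = begin
      ((y * y) - (x * y)) * (y⁻¹ * y⁻¹)
        ≡⟨ solve 3 (λ x y y⁻¹ → (y :* y :- x :* y) :* (y⁻¹ :* y⁻¹) := (y :* y⁻¹) :* (y :* y⁻¹) :- (x :* y⁻¹) :* (y :* y⁻¹)) refl x y y⁻¹ ⟩
      ((y * y⁻¹) * (y * y⁻¹)) - ((x * y⁻¹) * (y * y⁻¹))
        ≡⟨ cong (λ v → (v * v) - ((x * y⁻¹) * v)) yy⁻¹≡1 ⟩
      (1# * 1#) - ((x * y⁻¹) * 1#)
        ≡⟨ cong₂ _-_ (*-identityʳ 1#) (*-identityʳ _) ⟩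
      1# - (x * y⁻¹)   ∎
      where open ≡-Reasoning

  cancel-inverse : ∀ {x x⁻¹} y → x * x⁻¹ ≡ 1# → x⁻¹ * (x * y) ≡ y
  cancel-inverse {x} {x⁻¹} y xx⁻¹≡1 = begin
    x⁻¹ * (x * y)    ≡⟨ solve 3 (λ x x⁻¹ y → x⁻¹ :* (x :* y) := y :* (x :* x⁻¹)) refl x x⁻¹ y ⟩
    y * (x * x⁻¹)    ≡⟨ cong (y *_) xx⁻¹≡1 ⟩
    y * 1#           ≡⟨ *-identityʳ y ⟩
    y                ∎
    where open ≡-Reasoning

  offset-by-ratio : ∀ {a c v x y y⁻¹} → y * y⁻¹ ≡ 1# → y * (c - a) ≡ x * v → c ≡ a + (x * y⁻¹) * v
  offset-by-ratio {a} {c} {v} {x} {y} {y⁻¹} yy⁻¹≡1 scaled = begin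
    c                              ≡⟨ solve 2 (λ a c → c := a :+ (c :- a)) refl a c ⟩
    a + (c - a)                    ≡⟨ cong (a +_) (sym (cancel-inverse (c - a) yy⁻¹≡1)) ⟩
    a + y⁻¹ * (y * (c - a))        ≡⟨ cong (λ w → a + y⁻¹ * w) scaled ⟩
    a + y⁻¹ * (x * v)              ≡⟨ solve 4 (λ a v x y⁻¹ → a :+ y⁻¹ :* (x :* v) := a :+ (x :* y⁻¹) :* v) refl a v x y⁻¹ ⟩
    a + (x * y⁻¹) * v              ∎
    where open ≡-Reasoning

  offset-difference : ∀ {z a c t u s w} → z ≡ a + t * u → z ≡ c + s * w → c - a ≡ (t * u) - (s * w)
  offset-difference {a = a} {c} {t} {u} {s} {w} refl z≡ = begin
    c - a                          ≡⟨ solve 3 (λ a c sw → c :- a := (c :+ sw) :- sw :- a) refl a c (s * w) ⟩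
    ((c + s * w) - (s * w)) - a    ≡⟨ cong (λ v → (v - (s * w)) - a) (sym z≡) ⟩
    ((a + t * u) - (s * w)) - a    ≡⟨ solve 3 (λ a tu sw → (a :+ tu) :- sw :- a := tu :- sw) refl a (t * u) (s * w) ⟩
    (t * u) - (s * w)              ∎
    where open ≡-Reasoning

  cramer-point : ∀ {a c u w Δ Δ⁻¹ τ σ} → Δ * Δ⁻¹ ≡ 1# → (τ * u) - (σ * w) ≡ Δ * (c - a) →
                 a + (τ * Δ⁻¹) * u ≡ c + (σ * Δ⁻¹) * w
  cramer-point {a} {c} {u} {w} {Δ} {Δ⁻¹} {τ} {σ} ΔΔ⁻¹≡1 cramer = begin
    a + (τ * Δ⁻¹) * u                               ≡⟨ solve 6 (λ a u w Δ⁻¹ τ σ → a :+ (τ :* Δ⁻¹) :* u := a :+ Δ⁻¹ :* (τ :* u :- σ :* w) :+ (σ :* Δ⁻¹) :* w) refl a u w Δ⁻¹ τ σ ⟩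
    a + Δ⁻¹ * ((τ * u) - (σ * w)) + (σ * Δ⁻¹) * w   ≡⟨ cong (λ v → a + Δ⁻¹ * v + (σ * Δ⁻¹) * w) cramer ⟩
    a + Δ⁻¹ * (Δ * (c - a)) + (σ * Δ⁻¹) * w         ≡⟨ cong (λ v → a + v + (σ * Δ⁻¹) * w) (cancel-inverse (c - a) ΔΔ⁻¹≡1) ⟩
    a + (c - a) + (σ * Δ⁻¹) * w                     ≡⟨ solve 3 (λ a c v → a :+ (c :- a) :+ v := c :+ v) refl a c ((σ * Δ⁻¹) * w) ⟩
    c + (σ * Δ⁻¹) * w                               ∎
    where open ≡-Reasoning

  origin-on-line : ∀ {a c d u p q υ⁻¹ e⁻¹} → (q - p) * e⁻¹ ≡ 1# →
                   c ≡ a + (p * υ⁻¹) * u → d ≡ a + (q * υ⁻¹) * u → a ≡ c + ((- p) * e⁻¹) * (d - c)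
  origin-on-line {a} {u = u} {p} {q} {υ⁻¹} {e⁻¹} ee⁻¹≡1 refl refl = sym (begin
    c + ((- p) * e⁻¹) * (d - c)        ≡⟨ solve 6 (λ a u p q υ⁻¹ e⁻¹ →
                                              (a :+ (p :* υ⁻¹) :* u) :+ ((:- p) :* e⁻¹) :* ((a :+ (q :* υ⁻¹) :* u) :- (a :+ (p :* υ⁻¹) :* u))
                                              := (a :+ (p :* υ⁻¹) :* u) :- ((p :* υ⁻¹) :* u) :* ((q :- p) :* e⁻¹)) refl a u p q υ⁻¹ e⁻¹ ⟩
    c - (x * ((q - p) * e⁻¹))          ≡⟨ cong (λ v → c - (x * v)) ee⁻¹≡1 ⟩
    c - (x * 1#)                       ≡⟨ cong (λ v → c - v) (*-identityʳ x) ⟩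
    c - x                              ≡⟨ solve 2 (λ a x → a :+ x :- x := a) refl a x ⟩
    a                                  ∎)
    where
    open ≡-Reasoning
    x = (p * υ⁻¹) * u
    c = a + x
    d = a + (q * υ⁻¹) * u

  -- Points of [A,B] are A + t u and points of [C,D] are C + s w.  If Δ ≠ 0 the supporting lines
  -- meet at t = τ/Δ, s = σ/Δ (Cramer's rule); if Δ = σ = 0 the four points are collinear and
  -- C, D sit at parameters π/υ and (π + ε)/υ on the line AB.
  module SegmentPair (A B C D : Point R) where
    u w r : Point R
    u = B −ᵥ A
    w = D −ᵥ C
    r = C −ᵥ A

    u₁ u₂ w₁ w₂ r₁ r₂ : Carrier
    u₁ = proj₁ u
    u₂ = proj₂ u
    w₁ = proj₁ w
    w₂ = proj₂ w
    r₁ = proj₁ r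
    r₂ = proj₂ r

    Δ τ σ π ε υ : Carrier
    Δ = cross u w
    τ = cross r w
    σ = cross r u
    π = dot r u
    ε = dot w u
    υ = dot u u

    MeetCondition : Set
    MeetCondition = (Δ ≢ 0# × InUnitRatio τ Δ × InUnitRatio σ Δ)
                  ⊎ (Δ ≡ 0# × σ ≡ 0# × ¬ (π < 0# × π + ε < 0#) × ¬ (0# < π - υ × 0# < (π + ε) - υ))

    0≤υ : 0# ≤ υ
    0≤υ = +-nonneg (square-nonneg u₁) (square-nonneg u₂)

    meeting-identities : ∀ {z t s} → AtParameter z A B t → AtParameter z C D s →
                         τ ≡ t * Δ × σ ≡ s * Δ × π + s * ε ≡ t * υ
    meeting-identities {t = t} {s} (zt₁ , zt₂) (zs₁ , zs₂) =
        trans (cong (λ v → cross v w) r≡tu-sw)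
          (solve 6 (λ t s u₁ u₂ w₁ w₂ → crossₚ (t :* u₁ :- s :* w₁) (t :* u₂ :- s :* w₂) w₁ w₂ := t :* crossₚ u₁ u₂ w₁ w₂)
                 refl t s u₁ u₂ w₁ w₂)
      , trans (cong (λ v → cross v u) r≡tu-sw)
          (solve 6 (λ t s u₁ u₂ w₁ w₂ → crossₚ (t :* u₁ :- s :* w₁) (t :* u₂ :- s :* w₂) u₁ u₂ := s :* crossₚ u₁ u₂ w₁ w₂)
                 refl t s u₁ u₂ w₁ w₂)
      , trans (cong (λ v → dot v u + s * ε) r≡tu-sw)
          (solve 6 (λ t s u₁ u₂ w₁ w₂ → dotₚ (t :* u₁ :- s :* w₁) (t :* u₂ :- s :* w₂) u₁ u₂ :+ s :* dotₚ w₁ w₂ u₁ u₂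
                                        := t :* dotₚ u₁ u₂ u₁ u₂)
                 refl t s u₁ u₂ w₁ w₂)
      where
      r≡tu-sw : r ≡ ((t * u₁) - (s * w₁) , (t * u₂) - (s * w₂))
      r≡tu-sw = cong₂ _,_ (offset-difference zt₁ zs₁) (offset-difference zt₂ zs₂)

    meet⇒condition : SegmentsMeet A B C D → MeetCondition
    meet⇒condition (z , (t , 0≤t , t≤1 , z-at-t) , (s , 0≤s , s≤1 , z-at-s)) = byCases (Δ ≟ 0#)
      where
      identities = meeting-identities z-at-t z-at-s
      τ≡tΔ = proj₁ identities
      σ≡sΔ = proj₁ (proj₂ identities)
      π+sε≡tυ = proj₂ (proj₂ identities)

      ratio : ∀ {x k} → x ≡ k * Δ → 0# ≤ k → k ≤ 1# → InUnitRatio x Δ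
      ratio refl = inUnitRatio-scaled

      tυ≤υ : t * υ ≤ υ
      tυ≤υ = 0≤y-x⇒x≤y (subst (0# ≤_) (trans (solve 3 (λ o t υ → (o :- t) :* υ := o :* υ :- t :* υ) refl 1# t υ)
                                                   (cong (λ v → v - (t * υ)) (*-identityˡ υ)))
                                          (*-nonneg (x≤y⇒0≤y-x t≤1) 0≤υ))

      not-both-before : ¬ (π < 0# × π + ε < 0#)
      not-both-before (π<0 , π+ε<0) = ≤⇒≯ (*-nonneg 0≤t 0≤υ) (subst (_< 0#) π+sε≡tυ π+sε<0)
        where
        π+sε<0 : π + s * ε < 0#
        π+sε<0 = subst (_< 0#) (solve 3 (λ π s ε → :- ((:- π) :+ s :* (:- ε)) := π :+ s :* ε) refl π s ε)
                   (0<x⇒-x<0 (convex-pos 0≤s s≤1 (x<0⇒0<-x π<0) (subst (0# <_) (sym (-‿+-comm π ε)) (x<0⇒0<-x π+ε<0))))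

      not-both-beyond : ¬ (0# < π - υ × 0# < (π + ε) - υ)
      not-both-beyond (0<π-υ , 0<π+ε-υ) = ≤⇒≯ tυ≤υ (0<y-x⇒x<y (subst (0# <_) shift 0<π-υ+sε))
        where
        0<π-υ+sε : 0# < (π - υ) + s * ε
        0<π-υ+sε = convex-pos 0≤s s≤1 0<π-υ (subst (0# <_) (solve 3 (λ π ε υ → (π :+ ε) :- υ := (π :- υ) :+ ε) refl π ε υ) 0<π+ε-υ)
        shift : (π - υ) + s * ε ≡ (t * υ) - υ
        shift = trans (solve 4 (λ π ε υ s → (π :- υ) :+ s :* ε := (π :+ s :* ε) :- υ) refl π ε υ s) (cong (λ v → v - υ) π+sε≡tυ)

      byCases : Dec (Δ ≡ 0#) → MeetCondition
      byCases (no Δ≢0)  = inj₁ (Δ≢0 , ratio τ≡tΔ 0≤t t≤1 , ratio σ≡sΔ 0≤s s≤1)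
      byCases (yes Δ≡0) = inj₂ (Δ≡0 , trans σ≡sΔ (trans (cong (s *_) Δ≡0) (zeroʳ s)) , not-both-before , not-both-beyond)

    collinear-meet : ∀ {p q υ⁻¹} → 0# < υ → υ * υ⁻¹ ≡ 1# →
                     AtParameter C A B (p * υ⁻¹) → AtParameter D A B (q * υ⁻¹) →
                     ¬ (p < 0# × q < 0#) → ¬ (0# < p - υ × 0# < q - υ) → SegmentsMeet A B C D
    collinear-meet {p} {q} {υ⁻¹} 0<υ υυ⁻¹≡1 C-at D-at not-before not-beyond = byPosition (classify p) (classify q)
      where
      Position : Carrier → Set
      Position x = x < 0# ⊎ (0# ≤ x × 0# ≤ υ - x) ⊎ υ < x

      classify : ∀ x → Position x
      classify x with <-total x 0# | <-total υ x
      ... | inj₁ x<0 | _        = inj₁ x<0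
      ... | inj₂ 0≤x | inj₁ υ<x = inj₂ (inj₂ υ<x)
      ... | inj₂ 0≤x | inj₂ x≤υ = inj₂ (inj₁ (to-≤ 0≤x , x≤y⇒0≤y-x (to-≤ x≤υ)))
        where
        to-≤ : ∀ {a b} → a ≡ b ⊎ b < a → b ≤ a
        to-≤ (inj₁ a≡b) = inj₂ (sym a≡b)
        to-≤ (inj₂ b<a) = inj₁ b<a

      unit : ∀ {x} → 0# ≤ x → 0# ≤ υ - x → 0# ≤ x * υ⁻¹ × x * υ⁻¹ ≤ 1#
      unit 0≤x 0≤υ-x = inUnitRatio⇒unit υυ⁻¹≡1 (inUnitRatio-between (inj₁ 0<υ) 0≤x 0≤υ-x)

      C-on-AB : 0# ≤ p → 0# ≤ υ - p → SegmentsMeet A B C D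
      C-on-AB 0≤p 0≤υ-p = C , (p * υ⁻¹ , proj₁ (unit 0≤p 0≤υ-p) , proj₂ (unit 0≤p 0≤υ-p) , C-at) , onSegment-start C D

      D-on-AB : 0# ≤ q → 0# ≤ υ - q → SegmentsMeet A B C D
      D-on-AB 0≤q 0≤υ-q = D , (q * υ⁻¹ , proj₁ (unit 0≤q 0≤υ-q) , proj₂ (unit 0≤q 0≤υ-q) , D-at) , onSegment-end C D

      -- C and D lie on opposite sides of A, which is then the point C + (−p/(q − p)) (D − C)
      A-on-CD : 0# < (- p) * (q - p) → 0# < (q - p) * q → SegmentsMeet A B C D
      A-on-CD 0<-p[q-p] 0<[q-p]q = through (inverse (q - p) q-p≢0)
        where
        q-p≢0 : q - p ≢ 0#
        q-p≢0 q-p≡0 = <⇒≢ 0<-p[q-p] (sym (trans (cong ((- p) *_) q-p≡0) (zeroʳ (- p))))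

        through : ∃[ e⁻¹ ] ((q - p) * e⁻¹ ≡ 1#) → SegmentsMeet A B C D
        through (e⁻¹ , ee⁻¹≡1) =
          A , onSegment-start A B ,
          ((- p) * e⁻¹ , proj₁ s-unit , proj₂ s-unit ,
           origin-on-line ee⁻¹≡1 (proj₁ C-at) (proj₁ D-at) , origin-on-line ee⁻¹≡1 (proj₂ C-at) (proj₂ D-at))
          where
          s-unit = inUnitRatio⇒unit ee⁻¹≡1
            (inj₁ 0<-p[q-p] , inj₁ (subst (0# <_) (solve 2 (λ p q → (q :- p) :* q := (q :- p) :* (q :- p) :- (:- p) :* (q :- p)) refl p q) 0<[q-p]q))

      byPosition : Position p → Position q → SegmentsMeet A B C D
      byPosition (inj₂ (inj₁ (0≤p , 0≤υ-p))) _ = C-on-AB 0≤p 0≤υ-p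
      byPosition _ (inj₂ (inj₁ (0≤q , 0≤υ-q))) = D-on-AB 0≤q 0≤υ-q
      byPosition (inj₁ p<0) (inj₁ q<0) = ⊥-elim (not-before (p<0 , q<0))
      byPosition (inj₂ (inj₂ υ<p)) (inj₂ (inj₂ υ<q)) = ⊥-elim (not-beyond (x<y⇒0<y-x υ<p , x<y⇒0<y-x υ<q))
      byPosition (inj₁ p<0) (inj₂ (inj₂ υ<q)) =
        A-on-CD (*-pos (x<0⇒0<-x p<0) (x<y⇒0<y-x p<q)) (*-pos (x<y⇒0<y-x p<q) (<-trans 0<υ υ<q))
        where p<q = <-trans p<0 (<-trans 0<υ υ<q)
      byPosition (inj₂ (inj₂ υ<p)) (inj₁ q<0) =
        A-on-CD (*-neg-neg (0<x⇒-x<0 (<-trans 0<υ υ<p)) (x<y⇒x-y<0 q<p)) (*-neg-neg (x<y⇒x-y<0 q<p) q<0)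
        where q<p = <-trans q<0 (<-trans 0<υ υ<p)

    condition⇒meet : A ≢ B → MeetCondition → SegmentsMeet A B C D
    condition⇒meet _ (inj₁ (Δ≢0 , τ-ratio , σ-ratio)) with inverse Δ Δ≢0
    ... | Δ⁻¹ , ΔΔ⁻¹≡1 = z , (τ * Δ⁻¹ , proj₁ t-unit , proj₂ t-unit , refl , refl)
                           , (σ * Δ⁻¹ , proj₁ s-unit , proj₂ s-unit , cramer-point ΔΔ⁻¹≡1 cramer₁ , cramer-point ΔΔ⁻¹≡1 cramer₂)
      where
      t-unit = inUnitRatio⇒unit ΔΔ⁻¹≡1 τ-ratio
      s-unit = inUnitRatio⇒unit ΔΔ⁻¹≡1 σ-ratio
      z : Point R
      z = (proj₁ A + (τ * Δ⁻¹) * u₁ , proj₂ A + (τ * Δ⁻¹) * u₂)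
      cramer₁ : (τ * u₁) - (σ * w₁) ≡ Δ * r₁
      cramer₁ = solve 6 (λ r₁ r₂ u₁ u₂ w₁ w₂ → crossₚ r₁ r₂ w₁ w₂ :* u₁ :- crossₚ r₁ r₂ u₁ u₂ :* w₁ := crossₚ u₁ u₂ w₁ w₂ :* r₁)
                        refl r₁ r₂ u₁ u₂ w₁ w₂
      cramer₂ : (τ * u₂) - (σ * w₂) ≡ Δ * r₂
      cramer₂ = solve 6 (λ r₁ r₂ u₁ u₂ w₁ w₂ → crossₚ r₁ r₂ w₁ w₂ :* u₂ :- crossₚ r₁ r₂ u₁ u₂ :* w₂ := crossₚ u₁ u₂ w₁ w₂ :* r₂)
                        refl r₁ r₂ u₁ u₂ w₁ w₂
    condition⇒meet A≢B (inj₂ (Δ≡0 , σ≡0 , not-before , not-beyond)) with inverse υ (>⇒≢ (dot-self-pos A≢B))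
    ... | υ⁻¹ , υυ⁻¹≡1 = collinear-meet (dot-self-pos A≢B) υυ⁻¹≡1 (C-at₁ , C-at₂) (D-at₁ , D-at₂) not-before not-beyond
      where
      C-at₁ = offset-by-ratio υυ⁻¹≡1 (trans
        (solve 4 (λ r₁ r₂ u₁ u₂ → dotₚ u₁ u₂ u₁ u₂ :* r₁ := dotₚ r₁ r₂ u₁ u₂ :* u₁ :+ crossₚ r₁ r₂ u₁ u₂ :* u₂) refl r₁ r₂ u₁ u₂)
        (drop-zero-term σ≡0))
      C-at₂ = offset-by-ratio υυ⁻¹≡1 (trans
        (solve 4 (λ r₁ r₂ u₁ u₂ → dotₚ u₁ u₂ u₁ u₂ :* r₂ := dotₚ r₁ r₂ u₁ u₂ :* u₂ :- crossₚ r₁ r₂ u₁ u₂ :* u₁) refl r₁ r₂ u₁ u₂)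
        (drop-zero-term⁻ σ≡0))
      σ-Δ≡0 : σ - Δ ≡ 0#
      σ-Δ≡0 = trans (cong₂ _-_ σ≡0 Δ≡0) (x-x≡0 0#)
      D-at₁ = offset-by-ratio υυ⁻¹≡1 (trans
        (solve 7 (λ a₁ c₁ d₁ r₂ u₁ u₂ w₂ → dotₚ u₁ u₂ u₁ u₂ :* (d₁ :- a₁)
                   := (dotₚ (c₁ :- a₁) r₂ u₁ u₂ :+ dotₚ (d₁ :- c₁) w₂ u₁ u₂) :* u₁ :+ (crossₚ (c₁ :- a₁) r₂ u₁ u₂ :- crossₚ u₁ u₂ (d₁ :- c₁) w₂) :* u₂)
               refl (proj₁ A) (proj₁ C) (proj₁ D) r₂ u₁ u₂ w₂)
        (drop-zero-term σ-Δ≡0))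
      D-at₂ = offset-by-ratio υυ⁻¹≡1 (trans
        (solve 7 (λ a₂ c₂ d₂ r₁ u₁ u₂ w₁ → dotₚ u₁ u₂ u₁ u₂ :* (d₂ :- a₂)
                   := (dotₚ r₁ (c₂ :- a₂) u₁ u₂ :+ dotₚ w₁ (d₂ :- c₂) u₁ u₂) :* u₂ :- (crossₚ r₁ (c₂ :- a₂) u₁ u₂ :- crossₚ u₁ u₂ w₁ (d₂ :- c₂)) :* u₁)
               refl (proj₂ A) (proj₂ C) (proj₂ D) r₁ u₁ u₂ w₁)
        (drop-zero-term⁻ σ-Δ≡0))

    meet⇔condition : A ≢ B → SegmentsMeet A B C D ⇔ MeetCondition
    meet⇔condition A≢B = mk⇔ meet⇒condition (condition⇒meet A≢B)

  complement-≤1 : ∀ {k k′} → 0# ≤ k′ → k + k′ ≡ 1# → k ≤ 1#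
  complement-≤1 {k} {k′} 0≤k′ k+k′≡1 =
    0≤y-x⇒x≤y (subst (0# ≤_) (trans (solve 2 (λ k k′ → k′ := (k :+ k′) :- k) refl k k′) (cong (λ v → v - k) k+k′≡1)) 0≤k′)

  module SharedEndpoint (A B D : Point R) where
    u w : Point R
    u = B −ᵥ A
    w = D −ᵥ A

    u₁ u₂ w₁ w₂ : Carrier
    u₁ = proj₁ u
    u₂ = proj₂ u
    w₁ = proj₁ w
    w₂ = proj₂ w

    κ υ : Carrier
    κ = dot u w
    υ = dot u u

    OverlapCondition : Set
    OverlapCondition = cross u w ≡ 0# × 0# < κ

    overlap⇒condition : A ≢ B → OverlapBeyond A B D → OverlapCondition
    overlap⇒condition A≢B (z , (t , 0≤t , _ , zt₁ , zt₂) , (s , 0≤s , _ , zs₁ , zs₂) , z≢A) =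
      *-cancelˡ-0 (>⇒≢ 0<s) s×cross≡0 , pos-*-cancelˡ 0<s (subst (0# <_) (sym s×κ≡tυ) (*-pos 0<t (dot-self-pos A≢B)))
      where
      positive : ∀ {k q} → 0# ≤ k → AtParameter z A q k → 0# < k
      positive (inj₁ 0<k) _ = 0<k
      positive (inj₂ refl) z-at = ⊥-elim (z≢A (atParameter-zero z-at))

      0<t = positive 0≤t (zt₁ , zt₂)
      0<s = positive 0≤s (zs₁ , zs₂)

      tu₁≡sw₁ : t * u₁ ≡ s * w₁
      tu₁≡sw₁ = +-cancelˡ (proj₁ A) _ _ (trans (sym zt₁) zs₁)
      tu₂≡sw₂ : t * u₂ ≡ s * w₂
      tu₂≡sw₂ = +-cancelˡ (proj₂ A) _ _ (trans (sym zt₂) zs₂)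

      s×cross≡0 : s * cross u w ≡ 0#
      s×cross≡0 = begin
        s * cross u w                           ≡⟨ solve 5 (λ s u₁ u₂ w₁ w₂ → s :* crossₚ u₁ u₂ w₁ w₂ := u₁ :* (s :* w₂) :- u₂ :* (s :* w₁)) refl s u₁ u₂ w₁ w₂ ⟩
        (u₁ * (s * w₂)) - (u₂ * (s * w₁))       ≡⟨ cong₂ (λ x y → (u₁ * x) - (u₂ * y)) (sym tu₂≡sw₂) (sym tu₁≡sw₁) ⟩
        (u₁ * (t * u₂)) - (u₂ * (t * u₁))       ≡⟨ solve 3 (λ t u₁ u₂ → u₁ :* (t :* u₂) :- u₂ :* (t :* u₁) := con (ℤ.+ 0)) refl t u₁ u₂ ⟩
        0#                                      ∎
        where open ≡-Reasoning

      s×κ≡tυ : s * κ ≡ t * υ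
      s×κ≡tυ = begin
        s * κ                                   ≡⟨ solve 5 (λ s u₁ u₂ w₁ w₂ → s :* dotₚ u₁ u₂ w₁ w₂ := u₁ :* (s :* w₁) :+ u₂ :* (s :* w₂)) refl s u₁ u₂ w₁ w₂ ⟩
        u₁ * (s * w₁) + u₂ * (s * w₂)           ≡⟨ cong₂ (λ x y → u₁ * x + u₂ * y) (sym tu₁≡sw₁) (sym tu₂≡sw₂) ⟩
        u₁ * (t * u₁) + u₂ * (t * u₂)           ≡⟨ solve 3 (λ t u₁ u₂ → u₁ :* (t :* u₁) :+ u₂ :* (t :* u₂) := t :* dotₚ u₁ u₂ u₁ u₂) refl t u₁ u₂ ⟩
        t * υ                                   ∎
        where open ≡-Reasoning

    -- the witness A + κ/(κ + υ) · u = A + υ/(κ + υ) · w, whose two parameters sum to 1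
    condition⇒overlap : A ≢ B → OverlapCondition → OverlapBeyond A B D
    condition⇒overlap A≢B (cross≡0 , 0<κ) = witness (inverse (κ + υ) (>⇒≢ 0<κ+υ))
      where
      0<υ = dot-self-pos A≢B
      0<κ+υ = +-pos-nonneg 0<κ (inj₁ 0<υ)

      witness : ∃[ m ] ((κ + υ) * m ≡ 1#) → OverlapBeyond A B D
      witness (m , [κ+υ]m≡1) =
          z , (κ * m , 0≤κm , complement-≤1 0≤υm κm+υm≡1 , refl , refl)
            , (υ * m , 0≤υm , complement-≤1 0≤κm (trans (+-comm _ _) κm+υm≡1) , same-point υw₁≡κu₁ , same-point υw₂≡κu₂)
            , z≢A
        where
        0<m = inverse-pos 0<κ+υ [κ+υ]m≡1
        0≤κm = inj₁ (*-pos 0<κ 0<m)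
        0≤υm = *-nonneg (inj₁ 0<υ) (inj₁ 0<m)
        κm+υm≡1 : κ * m + υ * m ≡ 1#
        κm+υm≡1 = trans (sym (distribʳ m κ υ)) [κ+υ]m≡1

        z : Point R
        z = (proj₁ A + (κ * m) * u₁ , proj₂ A + (κ * m) * u₂)

        υw₁≡κu₁ : υ * w₁ ≡ κ * u₁
        υw₁≡κu₁ = trans (solve 4 (λ u₁ u₂ w₁ w₂ → dotₚ u₁ u₂ u₁ u₂ :* w₁ := dotₚ u₁ u₂ w₁ w₂ :* u₁ :- crossₚ u₁ u₂ w₁ w₂ :* u₂) refl u₁ u₂ w₁ w₂)
                        (drop-zero-term⁻ cross≡0)
        υw₂≡κu₂ : υ * w₂ ≡ κ * u₂
        υw₂≡κu₂ = trans (solve 4 (λ u₁ u₂ w₁ w₂ → dotₚ u₁ u₂ u₁ u₂ :* w₂ := dotₚ u₁ u₂ w₁ w₂ :* u₂ :+ crossₚ u₁ u₂ w₁ w₂ :* u₁) refl u₁ u₂ w₁ w₂)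
                        (drop-zero-term cross≡0)

        same-point : ∀ {a x y} → υ * y ≡ κ * x → a + (κ * m) * x ≡ a + (υ * m) * y
        same-point {a} {x} {y} υy≡κx = cong (a +_) (begin
          (κ * m) * x    ≡⟨ solve 3 (λ κ m x → (κ :* m) :* x := m :* (κ :* x)) refl κ m x ⟩
          m * (κ * x)    ≡⟨ cong (m *_) (sym υy≡κx) ⟩
          m * (υ * y)    ≡⟨ solve 3 (λ υ m y → m :* (υ :* y) := (υ :* m) :* y) refl υ m y ⟩
          (υ * m) * y    ∎)
          where open ≡-Reasoning

        z≢A : z ≢ A
        z≢A z≡A = >⇒≢ (*-pos (*-pos 0<κ 0<m) 0<υ) (begin
          (κ * m) * υ                                       ≡⟨ solve 3 (λ k u₁ u₂ → k :* dotₚ u₁ u₂ u₁ u₂ := (k :* u₁) :* u₁ :+ (k :* u₂) :* u₂) refl (κ * m) u₁ u₂ ⟩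
          ((κ * m) * u₁) * u₁ + ((κ * m) * u₂) * u₂         ≡⟨ cong₂ (λ x y → x * u₁ + y * u₂) (vanishes (cong proj₁ z≡A)) (vanishes (cong proj₂ z≡A)) ⟩
          0# * u₁ + 0# * u₂                                 ≡⟨ trans (cong₂ _+_ (zeroˡ u₁) (zeroˡ u₂)) (+-identityʳ 0#) ⟩
          0#                                                ∎)
          where
          open ≡-Reasoning
          vanishes : ∀ {a x} → a + x ≡ a → x ≡ 0#
          vanishes {a} {x} a+x≡a = +-cancelˡ a x 0# (trans a+x≡a (sym (+-identityʳ a)))

    overlap⇔condition : A ≢ B → OverlapBeyond A B D ⇔ OverlapCondition
    overlap⇔condition A≢B = mk⇔ (overlap⇒condition A≢B) (condition⇒overlap A≢B)

ExprPoint : ℕ → Set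
ExprPoint N = Expr N × Expr N

varPoint : ∀ {N} → Fin N × Fin N → ExprPoint N
varPoint (i , j) = (var i , var j)

infixl 6 _−ₑ_
_−ₑ_ : ∀ {N} → ExprPoint N → ExprPoint N → ExprPoint N
q −ₑ p = (proj₁ q ⊖ proj₁ p , proj₂ q ⊖ proj₂ p)

crossₑ dotₑ : ∀ {N} → ExprPoint N → ExprPoint N → Expr N
crossₑ u w = proj₁ u ⊗ proj₂ w ⊖ proj₂ u ⊗ proj₁ w
dotₑ   u w = proj₁ u ⊗ proj₁ w ⊕ proj₂ u ⊗ proj₂ w

inUnitRatioᶠ : ∀ {N} → Expr N → Expr N → Formula N
inUnitRatioᶠ a b = atomₑ (a ⊗ b) ge ∧ₑ atomₑ (b ⊗ b ⊖ a ⊗ b) ge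

segmentsMeetᶠ : ∀ {N} (A B C D : Fin N × Fin N) → Formula N
segmentsMeetᶠ A B C D =
     (¬ₑ atomₑ Δ eq ∧ₑ inUnitRatioᶠ τ Δ ∧ₑ inUnitRatioᶠ σ Δ)
  ∨ₑ (atomₑ Δ eq ∧ₑ atomₑ σ eq ∧ₑ ¬ₑ (atomₑ π lt ∧ₑ atomₑ (π ⊕ ε) lt) ∧ₑ ¬ₑ (atomₑ (π ⊖ υ) gt ∧ₑ atomₑ (π ⊕ ε ⊖ υ) gt))
  where
  u = varPoint B −ₑ varPoint A
  w = varPoint D −ₑ varPoint C
  r = varPoint C −ₑ varPoint A
  Δ = crossₑ u w
  τ = crossₑ r w
  σ = crossₑ r u
  π = dotₑ r u
  ε = dotₑ w u
  υ = dotₑ u u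

overlapᶠ : ∀ {N} (A B D : Fin N × Fin N) → Formula N
overlapᶠ A B D = atomₑ (crossₑ u w) eq ∧ₑ atomₑ (dotₑ u w) gt
  where
  u = varPoint B −ₑ varPoint A
  w = varPoint D −ₑ varPoint A

-- decided by evaluation, since degree (var i) does not depend on i
degreeBound-segmentsMeetᶠ : ∀ {N} (A B C D : Fin N × Fin N) → DegreeBound 6 (segmentsMeetᶠ A B C D)
degreeBound-segmentsMeetᶠ A B C D = from-yes (degreeBound? 6 (segmentsMeetᶠ A B C D))

degreeBound-overlapᶠ : ∀ {N} (A B D : Fin N × Fin N) → DegreeBound 6 (overlapᶠ A B D)
degreeBound-overlapᶠ A B D = from-yes (degreeBound? 6 (overlapᶠ A B D))

module GeometricFormulaSemantics (R : RealField) where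
  open RealField R using (Carrier)
  open Geometry R
  open FormulaSemantics R

  point : ∀ {N} → (Fin N → Carrier) → Fin N × Fin N → Point R
  point x (i , j) = (x i , x j)

  -- Holds unfolds these formulas definitionally to MeetCondition and OverlapCondition.
  Holds-segmentsMeetᶠ : ∀ {N} (A B C D : Fin N × Fin N) x → point x A ≢ point x B →
                        Holds (segmentsMeetᶠ A B C D) x ⇔ SegmentsMeet (point x A) (point x B) (point x C) (point x D)
  Holds-segmentsMeetᶠ A B C D x A≢B = ⇔-sym (SegmentPair.meet⇔condition (point x A) (point x B) (point x C) (point x D) A≢B)

  Holds-overlapᶠ : ∀ {N} (A B D : Fin N × Fin N) x → point x A ≢ point x B →
                   Holds (overlapᶠ A B D) x ⇔ OverlapBeyond (point x A) (point x B) (point x D)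
  Holds-overlapᶠ A B D x A≢B = ⇔-sym (SharedEndpoint.overlap⇔condition (point x A) (point x B) (point x D) A≢B)

module _ where
  open import Data.Nat using (_+_; _*_; _≤_)

  n≤n*n : ∀ k → k ≤ k * k
  n≤n*n zero    = z≤n
  n≤n*n (suc k) = ℕ.m≤m*n (suc k) (suc k)

  nested-size : ∀ {k j M} c → k ≤ M → j ≤ M → k * (j * c + 1) + 1 ≤ (c + 1) * (M * M) + 1
  nested-size {k} {j} {M} c k≤M j≤M = ℕ.+-monoˡ-≤ 1 (begin
    k * (j * c + 1)          ≤⟨ ℕ.*-mono-≤ k≤M (ℕ.+-monoˡ-≤ 1 (ℕ.*-monoˡ-≤ c j≤M)) ⟩
    M * (M * c + 1)          ≡⟨ solve 2 (λ M c → M :* (M :* c :+ con 1) := c :* (M :* M) :+ M) refl M c ⟩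
    c * (M * M) + M          ≤⟨ ℕ.+-monoʳ-≤ (c * (M * M)) (n≤n*n M) ⟩
    c * (M * M) + M * M      ≡⟨ solve 2 (λ M c → c :* (M :* M) :+ M :* M := (c :+ con 1) :* (M :* M)) refl M c ⟩
    (c + 1) * (M * M)        ∎)
    where
    open ℕ.≤-Reasoning
    open import Data.Nat.Solver using (module +-*-Solver)
    open +-*-Solver

module Encoding {n m : ℕ} (G : SimpleGraph n m) (ℓ : ℕ) where
  open SimpleGraph G
  open import Data.Nat using (_+_; _*_; _^_; _≤_; _<_)

  N : ℕ
  N = 2 * n + m

  xVar yVar : Fin n → Fin N
  xVar v = (v ↑ˡ (n + 0)) ↑ˡ m
  yVar v = (n ↑ʳ (v ↑ˡ 0)) ↑ˡ m

  colourVar : Fin m → Fin N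
  colourVar e = (2 * n) ↑ʳ e

  vertexVar : Fin n → Fin N × Fin N
  vertexVar v = (xVar v , yVar v)

  Ends : Fin m → Fin n → Fin n → Set
  Ends e a b = (proj₁ (edge e) ≡ a × proj₂ (edge e) ≡ b) ⊎ (proj₁ (edge e) ≡ b × proj₂ (edge e) ≡ a)

  data EndpointView (e f : Fin m) : Set where
    disjoint : (∀ v → IncidentTo v e → ¬ IncidentTo v f) → EndpointView e f
    shareEnd : ∀ a b d → Ends e a b → Ends f a d → EndpointView e f

  endpointView : ∀ e f → EndpointView e f
  endpointView e f with proj₁ (edge e) Fin.≟ proj₁ (edge f) | proj₁ (edge e) Fin.≟ proj₂ (edge f)
                      | proj₂ (edge e) Fin.≟ proj₁ (edge f) | proj₂ (edge e) Fin.≟ proj₂ (edge f)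
  ... | yes p≡r | _       | _       | _       = shareEnd _ _ _ (inj₁ (refl , refl)) (inj₁ (sym p≡r , refl))
  ... | no _    | yes p≡s | _       | _       = shareEnd _ _ _ (inj₁ (refl , refl)) (inj₂ (refl , sym p≡s))
  ... | no _    | no _    | yes q≡r | _       = shareEnd _ _ _ (inj₂ (refl , refl)) (inj₁ (sym q≡r , refl))
  ... | no _    | no _    | no _    | yes q≡s = shareEnd _ _ _ (inj₂ (refl , refl)) (inj₂ (refl , sym q≡s))
  ... | no p≢r  | no p≢s  | no q≢r  | no q≢s  = disjoint none
    where
    none : ∀ v → IncidentTo v e → ¬ IncidentTo v f
    none v (inj₁ v≡p) (inj₁ v≡r) = p≢r (trans (sym v≡p) v≡r)
    none v (inj₁ v≡p) (inj₂ v≡s) = p≢s (trans (sym v≡p) v≡s)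
    none v (inj₂ v≡q) (inj₁ v≡r) = q≢r (trans (sym v≡q) v≡r)
    none v (inj₂ v≡q) (inj₂ v≡s) = q≢s (trans (sym v≡q) v≡s)

  crossingᶠ′ : ∀ {e f} → EndpointView e f → Formula N
  crossingᶠ′ {e} {f} (disjoint _) =
    segmentsMeetᶠ (vertexVar (proj₁ (edge e))) (vertexVar (proj₂ (edge e))) (vertexVar (proj₁ (edge f))) (vertexVar (proj₂ (edge f)))
  crossingᶠ′ (shareEnd a b d _ _) = overlapᶠ (vertexVar a) (vertexVar b) (vertexVar d)

  crossingᶠ : Fin m → Fin m → Formula N
  crossingᶠ e f = crossingᶠ′ (endpointView e f)

  distinctᶠ : Fin n → Fin n → Formula N
  distinctᶠ u v = ¬ₑ (atomₑ (var (xVar u) ⊖ var (xVar v)) eq ∧ₑ atomₑ (var (yVar u) ⊖ var (yVar v)) eq)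

  hasColourᶠ : Fin m → Fin ℓ → Formula N
  hasColourᶠ e j = atomₑ (var (colourVar e) ⊖ lit (ℤ.+ toℕ j)) eq

  sameColourᶠ : Fin m → Fin m → Formula N
  sameColourᶠ e f = atomₑ (var (colourVar e) ⊖ var (colourVar f)) eq

  injectivityᶠ colouringᶠ noCrossingᶠ thicknessᶠ : Formula N
  injectivityᶠ = ⋀ n λ u → ⋀ n λ v → unless (u Fin.≟ v) (distinctᶠ u v)
  colouringᶠ   = ⋀ m λ e → ⋁ ℓ (hasColourᶠ e)
  noCrossingᶠ  = ⋀ m λ e → ⋀ m λ f → unless (e Fin.≟ f) (¬ₑ (sameColourᶠ e f ∧ₑ crossingᶠ e f))
  thicknessᶠ   = injectivityᶠ ∧ₑ colouringᶠ ∧ₑ noCrossingᶠ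

  degreeBound-crossingᶠ : ∀ e f → DegreeBound 6 (crossingᶠ e f)
  degreeBound-crossingᶠ e f with endpointView e f
  ... | disjoint _         = degreeBound-segmentsMeetᶠ (vertexVar (proj₁ (edge e))) (vertexVar (proj₂ (edge e)))
                                                       (vertexVar (proj₁ (edge f))) (vertexVar (proj₂ (edge f)))
  ... | shareEnd a b d _ _ = degreeBound-overlapᶠ (vertexVar a) (vertexVar b) (vertexVar d)

  size-crossingᶠ : ∀ e f → size (crossingᶠ e f) ≤ 11
  size-crossingᶠ e f with endpointView e f
  ... | disjoint _         = ℕ.≤-refl
  ... | shareEnd a b d _ _ = s≤s (s≤s z≤n)

  degreeBound-thicknessᶠ : DegreeBound 6 thicknessᶠ
  degreeBound-thicknessᶠ =
      degreeBound-⋀ n _ (λ u → degreeBound-⋀ n _ (λ v → degreeBound-unless (u Fin.≟ v) (s≤s z≤n , s≤s z≤n)))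
    , degreeBound-⋀ m _ (λ e → degreeBound-⋁ ℓ _ (λ j → s≤s z≤n))
    , degreeBound-⋀ m _ (λ e → degreeBound-⋀ m _ (λ f → degreeBound-unless (e Fin.≟ f) (s≤s z≤n , degreeBound-crossingᶠ e f)))

  size-injectivityᶠ : size injectivityᶠ ≤ n * (n * 2 + 1) + 1
  size-injectivityᶠ = size-⋀ n _ (λ u → size-⋀ n _ (λ v → size-unless (u Fin.≟ v) (s≤s z≤n) ℕ.≤-refl))

  size-colouringᶠ : size colouringᶠ ≤ m * (ℓ * 1 + 1) + 1
  size-colouringᶠ = size-⋀ m _ (λ e → size-⋁ ℓ _ (λ j → ℕ.≤-refl))

  size-noCrossingᶠ : size noCrossingᶠ ≤ m * (m * 12 + 1) + 1
  size-noCrossingᶠ = size-⋀ m _ (λ e → size-⋀ m _ (λ f → size-unless (e Fin.≟ f) (s≤s z≤n) (s≤s (size-crossingᶠ e f))))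

  size-thicknessᶠ : ℓ < m → m ≤ n * n → size thicknessᶠ ≤ 18 * (n ^ 4 + 1)
  size-thicknessᶠ ℓ<m m≤n² = begin
    size injectivityᶠ + (size colouringᶠ + size noCrossingᶠ)
      ≤⟨ ℕ.+-mono-≤ (ℕ.≤-trans size-injectivityᶠ (nested-size 2 n≤n² n≤n²))
                    (ℕ.+-mono-≤ (ℕ.≤-trans size-colouringᶠ (nested-size 1 m≤n² ℓ≤n²))
                                (ℕ.≤-trans size-noCrossingᶠ (nested-size 12 m≤n² m≤n²))) ⟩
    (3 * (n * n * (n * n)) + 1) + ((2 * (n * n * (n * n)) + 1) + (13 * (n * n * (n * n)) + 1))
      ≡⟨ solve 1 (λ n → (con 3 :* (n :* n :* (n :* n)) :+ con 1) :+ ((con 2 :* (n :* n :* (n :* n)) :+ con 1) :+ (con 13 :* (n :* n :* (n :* n)) :+ con 1))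
                        := con 18 :* (n :^ 4) :+ con 3) refl n ⟩
    18 * n ^ 4 + 3
      ≤⟨ ℕ.+-monoʳ-≤ (18 * n ^ 4) (s≤s (s≤s (s≤s z≤n))) ⟩
    18 * n ^ 4 + 18
      ≡⟨ sym (ℕ.*-distribˡ-+ 18 (n ^ 4) 1) ⟩
    18 * (n ^ 4 + 1)  ∎
    where
    open ℕ.≤-Reasoning
    open import Data.Nat.Solver using (module +-*-Solver)
    open +-*-Solver
    n≤n² = n≤n*n n
    ℓ≤n² = ℕ.≤-trans (ℕ.<⇒≤ ℓ<m) m≤n²

module EncodingSemantics (R : RealField) {n m : ℕ} (G : SimpleGraph n m) (ℓ : ℕ) where
  open OrderedField R
  open Geometry R
  open FormulaSemantics R
  open GeometricFormulaSemantics R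
  open SimpleGraph G
  open Encoding G ℓ
  open Equivalence using (to; from)

  ends-incident : ∀ {e a b v} → Ends e a b → IncidentTo v e → v ≡ a ⊎ v ≡ b
  ends-incident (inj₁ (p≡a , q≡b)) (inj₁ v≡p) = inj₁ (trans v≡p p≡a)
  ends-incident (inj₁ (p≡a , q≡b)) (inj₂ v≡q) = inj₂ (trans v≡q q≡b)
  ends-incident (inj₂ (p≡b , q≡a)) (inj₁ v≡p) = inj₂ (trans v≡p p≡b)
  ends-incident (inj₂ (p≡b , q≡a)) (inj₂ v≡q) = inj₁ (trans v≡q q≡a)

  ends-incidentˡ : ∀ {e a b} → Ends e a b → IncidentTo a e
  ends-incidentˡ (inj₁ (p≡a , _)) = inj₁ (sym p≡a)
  ends-incidentˡ (inj₂ (_ , q≡a)) = inj₂ (sym q≡a)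

  ends-distinct : ∀ {e a b} → Ends e a b → a ≢ b
  ends-distinct {e} (inj₁ (p≡a , q≡b)) a≡b = loopless e (trans p≡a (trans a≡b (sym q≡b)))
  ends-distinct {e} (inj₂ (p≡b , q≡a)) a≡b = loopless e (trans p≡b (trans (sym a≡b) (sym q≡a)))

  ends-unique : ∀ {e f a b} → e ≢ f → Ends e a b → Ends f a b → ⊥
  ends-unique {e} {f} e≢f (inj₁ (p≡a , q≡b)) (inj₁ (r≡a , s≡b)) = noMulti e f e≢f (inj₁ (trans p≡a (sym r≡a) , trans q≡b (sym s≡b)))
  ends-unique {e} {f} e≢f (inj₁ (p≡a , q≡b)) (inj₂ (r≡b , s≡a)) = noMulti e f e≢f (inj₂ (trans p≡a (sym s≡a) , trans q≡b (sym r≡b)))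
  ends-unique {e} {f} e≢f (inj₂ (p≡b , q≡a)) (inj₁ (r≡a , s≡b)) = noMulti e f e≢f (inj₂ (trans p≡b (sym s≡b) , trans q≡a (sym r≡a)))
  ends-unique {e} {f} e≢f (inj₂ (p≡b , q≡a)) (inj₂ (r≡b , s≡a)) = noMulti e f e≢f (inj₁ (trans p≡b (sym r≡b) , trans q≡a (sym s≡a)))

  shared-end-unique : ∀ {e f a b d v} → e ≢ f → Ends e a b → Ends f a d → IncidentTo v e → IncidentTo v f → v ≡ a
  shared-end-unique e≢f ends-e ends-f v∈e v∈f with ends-incident ends-e v∈e | ends-incident ends-f v∈f
  ... | inj₁ v≡a | _        = v≡a
  ... | inj₂ _   | inj₁ v≡a = v≡a
  ... | inj₂ v≡b | inj₂ v≡d = ⊥-elim (ends-unique e≢f ends-e (subst (Ends _ _) (trans (sym v≡d) v≡b) ends-f))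

  module _ (Γ : Drawing R n) where
    open Drawing Γ

    onSegment-ends : ∀ {e a b z} → Ends e a b → OnSegment R z (segment₁ R G Γ e) (segment₂ R G Γ e) ⇔ OnSegment R z (pos a) (pos b)
    onSegment-ends {z = z} (inj₁ (p≡a , q≡b)) = K-reflexive (cong₂ (λ a b → OnSegment R z (pos a) (pos b)) p≡a q≡b)
    onSegment-ends {z = z} (inj₂ (p≡b , q≡a)) =
      mk⇔ onSegment-sym onSegment-sym ⇔-∘ K-reflexive (cong₂ (λ a b → OnSegment R z (pos a) (pos b)) p≡b q≡a)

    Cross⇔segmentsMeet : ∀ {e f} → (∀ v → IncidentTo v e → ¬ IncidentTo v f) →
                         Cross R G Γ e f ⇔ SegmentsMeet (segment₁ R G Γ e) (segment₂ R G Γ e) (segment₁ R G Γ f) (segment₂ R G Γ f)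
    Cross⇔segmentsMeet none = mk⇔ (λ (z , z∈e , z∈f , _) → z , z∈e , z∈f)
                                  (λ (z , z∈e , z∈f) → z , z∈e , z∈f , λ (v , v∈e , v∈f , _) → none v v∈e v∈f)

    Cross⇔overlap : ∀ {e f a b d} → e ≢ f → Ends e a b → Ends f a d → Cross R G Γ e f ⇔ OverlapBeyond (pos a) (pos b) (pos d)
    Cross⇔overlap {a = a} e≢f ends-e ends-f = mk⇔
      (λ (z , z∈e , z∈f , not-end) →
         z , to (onSegment-ends ends-e) z∈e , to (onSegment-ends ends-f) z∈f ,
         λ z≡a → not-end (a , ends-incidentˡ ends-e , ends-incidentˡ ends-f , z≡a))
      (λ (z , z∈ab , z∈ad , z≢a) →
         z , from (onSegment-ends ends-e) z∈ab , from (onSegment-ends ends-f) z∈ad ,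
         λ (v , v∈e , v∈f , z≡v) → z≢a (trans z≡v (cong pos (shared-end-unique e≢f ends-e ends-f v∈e v∈f))))

  Cross-transport : ∀ {Γ Γ′ : Drawing R n} {e f} → (∀ v → Drawing.pos Γ v ≡ Drawing.pos Γ′ v) → Cross R G Γ e f → Cross R G Γ′ e f
  Cross-transport {e = e} {f} pos≗ (z , z∈e , z∈f , not-end) =
    z , subst₂ (OnSegment R z) (pos≗ _) (pos≗ _) z∈e , subst₂ (OnSegment R z) (pos≗ _) (pos≗ _) z∈f ,
    λ (v , v∈e , v∈f , z≡v) → not-end (v , v∈e , v∈f , trans z≡v (sym (pos≗ v)))

  position : (Fin N → Carrier) → Fin n → Point R
  position x v = point x (vertexVar v)

  drawingFrom : (x : Fin N → Carrier) → (∀ u v → position x u ≡ position x v → u ≡ v) → Drawing R n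
  drawingFrom x injective = record { pos = position x ; injective = injective }

  crossingᶠ-correct : ∀ x injective {e f} → e ≢ f → Holds (crossingᶠ e f) x ⇔ Cross R G (drawingFrom x injective) e f
  crossingᶠ-correct x injective {e} {f} e≢f = byView (endpointView e f)
    where
    Γ = drawingFrom x injective

    distinct-points : ∀ {a b} → a ≢ b → position x a ≢ position x b
    distinct-points a≢b same = a≢b (injective _ _ same)

    byView : (view : EndpointView e f) → Holds (crossingᶠ′ view) x ⇔ Cross R G Γ e f
    byView (disjoint none) =
      ⇔-sym (Cross⇔segmentsMeet Γ none) ⇔-∘ Holds-segmentsMeetᶠ _ _ _ _ x (distinct-points (loopless e))
    byView (shareEnd a b d ends-e ends-f) =
      ⇔-sym (Cross⇔overlap Γ e≢f ends-e ends-f) ⇔-∘ Holds-overlapᶠ _ _ _ x (distinct-points (ends-distinct ends-e))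

  sound : ∀ x → Holds thicknessᶠ x → LayerDrawing R G ℓ
  sound x (injectivity , colouring , noCrossing) = record { Γ = Γ ; χ = χ ; noMonoCrossing = no-mono }
    where
    distinct : ∀ u v → u ≢ v → Holds (distinctᶠ u v) x
    distinct u v = to (Holds-unless (u Fin.≟ v) _ x) (to (Holds-⋀ n _ x) (to (Holds-⋀ n _ x) injectivity u) v)

    injective : ∀ u v → position x u ≡ position x v → u ≡ v
    injective u v same = decidable-stable (u Fin.≟ v) λ u≢v →
      distinct u v u≢v (x≡y⇒x-y≡0 (cong proj₁ same) , x≡y⇒x-y≡0 (cong proj₂ same))

    Γ = drawingFrom x injective

    colour : ∀ e → ∃[ j ] Holds (hasColourᶠ e j) x
    colour e = to (Holds-⋁ ℓ _ x) (to (Holds-⋀ m _ x) colouring e)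

    χ : Fin m → Fin ℓ
    χ e = proj₁ (colour e)

    colour≡χ : ∀ e → x (colourVar e) ≡ fromℕ (toℕ (χ e))
    colour≡χ e = x-y≡0⇒x≡y (proj₂ (colour e))

    no-mono : ∀ e f → e ≢ f → χ e ≡ χ f → ¬ Cross R G Γ e f
    no-mono e f e≢f χe≡χf crossing =
      to (Holds-unless (e Fin.≟ f) _ x) (to (Holds-⋀ m _ x) (to (Holds-⋀ m _ x) noCrossing e) f) e≢f
        ( x≡y⇒x-y≡0 (trans (colour≡χ e) (trans (cong (fromℕ ∘ toℕ) χe≡χf) (sym (colour≡χ f))))
        , from (crossingᶠ-correct x injective e≢f) crossing)

  coordinates : (Fin n → Point R) → Fin (2 ℕ.* n) → Carrier
  coordinates p j = [ proj₁ ∘ p , [ proj₂ ∘ p , (λ ()) ] ∘ splitAt n ] (splitAt n j)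

  assignment : (Fin n → Point R) → (Fin m → Carrier) → Fin N → Carrier
  assignment p c i = [ coordinates p , c ] (splitAt (2 ℕ.* n) i)

  assignment-position : ∀ p c v → position (assignment p c) v ≡ p v
  assignment-position p c v = cong₂ _,_ x-coordinate y-coordinate
    where
    x-coordinate : assignment p c (xVar v) ≡ proj₁ (p v)
    x-coordinate rewrite Fin.splitAt-↑ˡ (2 ℕ.* n) (v ↑ˡ (n ℕ.+ 0)) m | Fin.splitAt-↑ˡ n v (n ℕ.+ 0) = refl
    y-coordinate : assignment p c (yVar v) ≡ proj₂ (p v)
    y-coordinate rewrite Fin.splitAt-↑ˡ (2 ℕ.* n) (n ↑ʳ (v ↑ˡ 0)) m | Fin.splitAt-↑ʳ n (n ℕ.+ 0) (v ↑ˡ 0) | Fin.splitAt-↑ˡ n v 0 = refl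

  assignment-colour : ∀ p c e → assignment p c (colourVar e) ≡ c e
  assignment-colour p c e rewrite Fin.splitAt-↑ʳ (2 ℕ.* n) m e = refl

  complete : LayerDrawing R G ℓ → ∃[ x ] Holds thicknessᶠ x
  complete drawing = x , injectivity , colouring , noCrossing
    where
    open LayerDrawing drawing
    open Drawing Γ

    x : Fin N → Carrier
    x = assignment pos (fromℕ ∘ toℕ ∘ χ)

    position≡pos : ∀ v → position x v ≡ pos v
    position≡pos = assignment-position pos _

    injective′ : ∀ u v → position x u ≡ position x v → u ≡ v
    injective′ u v same = injective u v (trans (sym (position≡pos u)) (trans same (position≡pos v)))

    same-colour : ∀ e f → x (colourVar e) - x (colourVar f) ≡ 0# → χ e ≡ χ f
    same-colour e f same = Fin.toℕ-injective (fromℕ-injective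
      (trans (sym (assignment-colour pos _ e)) (trans (x-y≡0⇒x≡y same) (assignment-colour pos _ f))))

    injectivity : Holds injectivityᶠ x
    injectivity = from (Holds-⋀ n _ x) λ u → from (Holds-⋀ n _ x) λ v → from (Holds-unless (u Fin.≟ v) _ x)
      λ u≢v (x-same , y-same) → u≢v (injective′ u v (cong₂ _,_ (x-y≡0⇒x≡y x-same) (x-y≡0⇒x≡y y-same)))

    colouring : Holds colouringᶠ x
    colouring = from (Holds-⋀ m _ x) λ e → from (Holds-⋁ ℓ _ x) (χ e , x≡y⇒x-y≡0 (assignment-colour pos _ e))

    noCrossing : Holds noCrossingᶠ x
    noCrossing = from (Holds-⋀ m _ x) λ e → from (Holds-⋀ m _ x) λ f → from (Holds-unless (e Fin.≟ f) _ x)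
      λ e≢f (same , crossing) → noMonoCrossing e f e≢f (same-colour e f same)
                                  (Cross-transport {drawingFrom x injective′} {Γ} position≡pos (to (crossingᶠ-correct x injective′ e≢f) crossing))

open import Data.Nat using (_+_; _*_; _^_; _≤_; _<_)

edges≤vertices² : ∀ {n m} (G : SimpleGraph n m) → m ≤ n * n
edges≤vertices² {n} G = Fin.injective⇒≤ {f = λ e → combine (proj₁ (edge e)) (proj₂ (edge e))} injective
  where
  open SimpleGraph G
  injective : ∀ {e f} → combine (proj₁ (edge e)) (proj₂ (edge e)) ≡ combine (proj₁ (edge f)) (proj₂ (edge f)) → e ≡ f
  injective {e} {f} same = decidable-stable (e Fin.≟ f) λ e≢f → noMulti e f e≢f (inj₁ (Fin.combine-injective _ _ _ _ same))

module _ (R : RealField) where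
  open RealField R using (fromℕ; 0#)
  open OrderedField R using (fromℕ-injective)
  open FormulaSemantics R using (Sat-compile)

  ETRFormulaFor : ∀ {n m} → SimpleGraph n m → ℕ → ℕ → Set
  ETRFormulaFor {n} {m} G ℓ c =
    ∃[ φ ] (AtomDegree≤ {2 * n + m} 6 φ × numAtoms φ ≤ c * (n ^ 4 + 1) × (TrueETR R φ ⇔ HasGeometricThickness≤ R G ℓ))

  layerPerEdge : ∀ {n m} (G : SimpleGraph n m) ℓ → m ≤ ℓ → LayerDrawing R G ℓ
  layerPerEdge G ℓ m≤ℓ = record
    { Γ = record { pos = λ v → (fromℕ (toℕ v) , 0#) ; injective = λ u v same → Fin.toℕ-injective (fromℕ-injective (cong proj₁ same)) }
    ; χ = λ e → inject≤ e m≤ℓ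
    ; noMonoCrossing = λ e f e≢f same _ → e≢f (Fin.inject≤-injective m≤ℓ m≤ℓ e f same)
    }

  many-layers-formula : ∀ {n m} (G : SimpleGraph n m) ℓ → m ≤ ℓ → ETRFormulaFor G ℓ 18
  many-layers-formula {n} {m} G ℓ m≤ℓ =
    compile trueₑ , atomDegree-compile (trueₑ {2 * n + m}) z≤n , ℕ.≤-trans (ℕ.m≤n+m 1 (n ^ 4)) (ℕ.m≤n*m (n ^ 4 + 1) 18) ,
    mk⇔ (λ _ → layerPerEdge G ℓ m≤ℓ) (λ _ → (λ _ → 0#) , Equivalence.from (Sat-compile (trueₑ {2 * n + m}) (λ _ → 0#)) refl)

  thicknessᶠ-correct : ∀ {n m} (G : SimpleGraph n m) ℓ → TrueETR R (compile (Encoding.thicknessᶠ G ℓ)) ⇔ LayerDrawing R G ℓ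
  thicknessᶠ-correct G ℓ = mk⇔
    (λ (x , sat) → EncodingSemantics.sound R G ℓ x (Equivalence.to (Sat-compile thicknessᶠ x) sat))
    (λ drawing → let (x , holds) = EncodingSemantics.complete R G ℓ drawing in x , Equivalence.from (Sat-compile thicknessᶠ x) holds)
    where open Encoding G ℓ using (thicknessᶠ)

  few-layers-formula : ∀ {n m} (G : SimpleGraph n m) ℓ → ℓ < m → ETRFormulaFor G ℓ 18
  few-layers-formula G ℓ ℓ<m =
    compile thicknessᶠ , atomDegree-compile thicknessᶠ degreeBound-thicknessᶠ ,
    size-thicknessᶠ ℓ<m (edges≤vertices² G) , thicknessᶠ-correct G ℓ
    where open Encoding G ℓ

mainTheorem8 : (R : RealField) →
    ∃[ c ] (∀ (n m : ℕ) (G : SimpleGraph n m) (ℓ : ℕ) →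
      ∃[ φ ] (AtomDegree≤ {2 * n + m} 6 φ ×
              numAtoms φ ≤ c * (n ^ 4 + 1) ×
              (TrueETR R φ ⇔ HasGeometricThickness≤ R G ℓ)))
mainTheorem8 R = 18 , formula
  where
  formula : ∀ n m (G : SimpleGraph n m) ℓ → ETRFormulaFor R G ℓ 18
  formula n m G ℓ with m ℕ.≤? ℓ
  ... | yes m≤ℓ = many-layers-formula R G ℓ m≤ℓ
  ... | no  m≰ℓ = few-layers-formula R G ℓ (ℕ.≰⇒> m≰ℓ)
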